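{- Let $A$ be a finite nonempty set and let $\sigma$ be a permutation of $A$ whose cycle-type is a binary partition (i.e., every cycle of $\sigma$ has length a power of $2$). \begin{itemize} \item If $\sigma$ has exactly one cycle, then $|\mathcal{B}_{\sigma}[A]|=1$. \item If $\sigma$ has more than one cycle, let $c$ be a cycle of $\sigma$ of maximal length, let $A'$ be the set $A$ with the elements of $c$ removed, and let $\sigma'$ be the restriction of $\sigma$ to $A'$. Then there is a bijection between $\mathcal{B}_{\sigma}[A]$ and $\mathcal{E}_{\sigma'}[A']$. \end{itemize}
   Context: For a finite set $A$ with $|A|=n\geq 1$, $\mathcal{B}[A]$ denotes the set of rooted binary trees that are non-embedded (the two children of each internal node are unordered) and have $n$ leaves carrying distinct labels from $A$ (phylogenetic trees). Such a tree has $n-1$ internal nodes; by convention it also has an additional root-edge above the root node (connected to a "fake vertex" not counted as a node), so that it has exactly $2n-1$ edges (for $n=1$ the tree is a single leaf with its root-edge). The symmetric group $\mathfrak{S}(A)$ acts on $\mathcal{B}[A]$: for $\gamma\in\mathcal{B}[A]$ and $\sigma\in\mathfrak{S}(A)$, $\sigma\cdot\gamma$ is obtained from $\gamma$ by replacing the label $i$ of every leaf by $\sigma(i)$. Define $\mathcal{B}_{\sigma}[A]=\{\gamma\in\mathcal{B}[A] : \sigma\cdot\gamma=\gamma\}$, and $\mathcal{E}_{\sigma}[A]$ as the set of pairs $(\gamma,e)$ with $\gamma\in\mathcal{B}_{\sigma}[A]$ and $e$ one of the $2n-1$ edges of $\gamma$. The cycle-type of $\sigma$ is the integer partition of $n$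 listing the cycle lengths of $\sigma$. -}

module Defs where

open import Data.Nat using (ℕ; zero; suc; _≤_; _<_; _^_)
open import Data.Fin using (Fin)
open import Data.Fin.Permutation using (Permutation′; _⟨$⟩ʳ_)
open import Data.List using (List; []; _∷_; _++_)
open import Data.List.Membership.Propositional using (_∈_)
open import Data.List.Relation.Unary.Unique.Propositional using (Unique)
open import Data.Product using (Σ; ∃; _×_; _,_; proj₁; proj₂)
open import Data.Unit using (⊤)
open import Function.Bundles using (_⇔_)
open import Relation.Binary.PropositionalEquality using (_≡_)
open import Relation.Nullary using (¬_)

module _ {n : ℕ} where

  iter : Permutation′ n → ℕ → Fin n → Fin n
  iter σ zero    x = x
  iter σ (suc k) x = σ ⟨$⟩ʳ (iter σ k x)

  SameCycle : Permutation′ n → Fin n → Fin n → Set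
  SameCycle σ x y = ∃ λ k → iter σ k x ≡ y

  IsCycleLen : Permutation′ n → Fin n → ℕ → Set
  IsCycleLen σ x k =
    1 ≤ k × iter σ k x ≡ x × (∀ m → 1 ≤ m → m < k → ¬ (iter σ m x ≡ x))

  BinaryCycleType : Permutation′ n → Set
  BinaryCycleType σ = ∀ x k → IsCycleLen σ x k → ∃ λ j → k ≡ 2 ^ j

  OneCycle : Permutation′ n → Set
  OneCycle σ = ∀ x y → SameCycle σ x y

  MaxCycle : Permutation′ n → Fin n → Set
  MaxCycle σ a = ∃ λ L → IsCycleLen σ a L × (∀ x k → IsCycleLen σ x k → k ≤ L)

  -- Rooted binary trees with leaves labelled in Fin n.
  -- Plane representatives; non-embeddedness is handled by the
  -- isomorphism _≅_ (swapping the children of any internal node).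

  data Tree : Set where
    leaf : Fin n → Tree
    node : Tree → Tree → Tree

  leaves : Tree → List (Fin n)
  leaves (leaf a)   = a ∷ []
  leaves (node l r) = leaves l ++ leaves r

  data _≅_ : Tree → Tree → Set where
    leaf≅    : ∀ a → leaf a ≅ leaf a
    straight : ∀ {l r l′ r′} → l ≅ l′ → r ≅ r′ → node l r ≅ node l′ r′
    cross    : ∀ {l r l′ r′} → l ≅ r′ → r ≅ l′ → node l r ≅ node l′ r′

  -- a phylogenetic tree on the label set A = {x | P x}:
  -- leaf labels are distinct and are exactly the elements of A
  Valid : (Fin n → Set) → Tree → Set
  Valid P t = Unique (leaves t) × (∀ x → (x ∈ leaves t) ⇔ P x)

  relabel : Permutation′ n → Tree → Tree
  relabel σ (leaf a)   = leaf (σ ⟨$⟩ʳ a)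
  relabel σ (node l r) = node (relabel σ l) (relabel σ r)

  -- B_σ[A] (representatives); equality is _≅_ on underlying trees
  Bσ : Permutation′ n → (Fin n → Set) → Set
  Bσ σ P = Σ Tree λ t → Valid P t × (relabel σ t ≅ t)

  _≈B_ : ∀ {σ P} → Bσ σ P → Bσ σ P → Set
  γ ≈B δ = proj₁ γ ≅ proj₁ δ

  -- Edges: each node (leaf or internal) corresponds to the edge above it;
  -- `here` at the top is the root-edge.  A tree with m leaves has 2m-1 edges.
  data Edge : Tree → Set where
    here : ∀ {t} → Edge t
    inl  : ∀ {l r} → Edge l → Edge (node l r)
    inr  : ∀ {l r} → Edge r → Edge (node l r)

  transport : ∀ {t t′} → t ≅ t′ → Edge t → Edge t′
  transport (leaf≅ a)        here    = here
  transport (straight e₁ e₂) here    = here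
  transport (straight e₁ e₂) (inl p) = inl (transport e₁ p)
  transport (straight e₁ e₂) (inr p) = inr (transport e₂ p)
  transport (cross e₁ e₂)    here    = here
  transport (cross e₁ e₂)    (inl p) = inr (transport e₁ p)
  transport (cross e₁ e₂)    (inr p) = inl (transport e₂ p)

  Eσ : Permutation′ n → (Fin n → Set) → Set
  Eσ σ P = Σ (Bσ σ P) λ γ → Edge (proj₁ γ)

  _≈E_ : ∀ {σ P} → Eσ σ P → Eσ σ P → Set
  (γ , e) ≈E (δ , e′) = Σ (proj₁ γ ≅ proj₁ δ) λ iso → transport iso e ≡ e′

  ExactlyOne : ∀ {σ P} → Set
  ExactlyOne {σ} {P} = Σ (Bσ σ P) λ γ → ∀ (δ : Bσ σ P) → δ ≈B γ

record Bij {A B : Set} (_≈A_ : A → A → Set) (_≈B_ : B → B → Set) : Set where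
  field
    f    : A → B
    cong : ∀ {x y} → x ≈A y → f x ≈B f y
    inj  : ∀ {x y} → f x ≈B f y → x ≈A y
    surj : ∀ y → ∃ λ x → f x ≈B y

Everything : ∀ {n} → Fin n → Set
Everything _ = ⊤

-- Let τ satisfy τ^(2^m) = id and let a lie on a τ-cycle C of length exactly 2^m; this is the situation
-- of a maximal cycle in a binary cycle type.  A τ-invariant tree whose leaves are exactly C is unique:
-- τ cannot fix both subtrees of the root, since each would be a τ-closed part of the single orbit C, so
-- it swaps them, and each subtree is a τ²-invariant tree on half of C.  By induction it is the complete
-- binary tree that splits C by the parity of the exponent at every level.
--
-- In general, deleting C from a τ-invariant tree leaves a τ-invariant tree on the remaining leaves and
-- marks the edge where the part containing a was attached.  Conversely, grafting the cycle tree onto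
-- that edge — and, at every node above it whose subtrees τ swaps, its τ-image onto the sibling, with τ
-- replaced by τ² and C by its half through a — recovers the tree.  Since τ^(2^m) = id, a node whose
-- subtrees are swapped needs m ≥ 1, so the halving never runs out.  Both constructions respect
-- isomorphism, which gives the bijection.  If C is the only cycle, uniqueness of the cycle tree is
-- the statement |B_σ[A]| = 1.

module Submission where

open import Defs
open import Data.Nat using (ℕ; zero; suc; _+_; _*_; _∸_; _≤_; _<_; _^_; NonZero; s≤s; z≤n; pred; _≤?_)
open import Data.Fin using (Fin; _≟_; zero; toℕ)
open import Data.Fin.Permutation using (_⟨$⟩ʳ_; Permutation′; _⟨$⟩ˡ_; inverseˡ)
open import Data.List using (List; []; _∷_; _++_)
open import Data.List.Membership.Propositional using (_∈_)
open import Data.List.Membership.Propositional.Properties using (∈-++⁺ˡ; ∈-++⁺ʳ; ∈-++⁻)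
open import Data.List.Relation.Unary.Any using (here; there)
open import Data.List.Relation.Unary.All using ([]; _∷_)
import Data.List.Relation.Unary.All as All
import Data.List.Relation.Unary.All.Properties as Allₚ
open import Data.List.Relation.Unary.AllPairs using ([]; _∷_)
open import Data.List.Relation.Unary.Unique.Propositional using (Unique)
import Data.List.Relation.Unary.Unique.Propositional.Properties as Unique
open import Data.Product using (Σ; ∃; _×_; _,_; proj₁; proj₂)
open import Data.Sum using (_⊎_; inj₁; inj₂; [_,_])
open import Data.Unit using (⊤; tt)
open import Data.Empty using (⊥; ⊥-elim)
open import Function using (_∘_; mk⇔; Equivalence)
open import Relation.Binary.PropositionalEquality
  using (_≡_; _≢_; refl; sym; trans; cong; cong₂; subst; module ≡-Reasoning)
open import Relation.Nullary using (¬_; Dec; yes; no; does)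
open import Relation.Nullary.Decidable using (map′; _⊎-dec_; dec-true; dec-false; does-⇔; _×-dec_)
open import Data.Nat.Properties
  using ( +-comm; m+[n∸m]≡n; m∸n+n≡m; <⇒≤; <-cmp; <-trans; n<1+n; m<n⇒0<n∸m; m∸n≤m; ≤-<-trans
        ; m^n≢0; m^n>0; *-monoʳ-<; *-monoʳ-≤; ≤-trans; m≤m+n; *-comm; anyUpTo?; *-cancelˡ-≡; *-cancelˡ-<
        ; suc-injective; even≢odd; <⇒≱; ≰⇒>; ^-monoʳ-<; ^-distribˡ-+-*)
open import Data.Nat.DivMod using (_%_; _/_; m≡m%n+[m/n]*n; m%n<n; m∣n⇒o%n%m≡o%m; [m+kn]%n≡m%n; m*n%n≡0)
open import Data.Nat.Divisibility using (_∣_; divides)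
open import Data.Nat.Tactic.RingSolver using (solve-∀)
open import Data.Bool using (Bool; true; false; if_then_else_)
open import Relation.Binary.Definitions using (tri<; tri≈; tri>)
open import Data.Maybe using (Maybe; just; nothing)
import Data.Maybe as Maybe
open import Data.Maybe.Properties using (just-injective)
open import Data.Nat.Induction using (<-rec)
open import Data.Fin.Properties using (pigeonhole; ¬∀⟶∃¬)

module _ {N : ℕ} where

  infix 4 _∈ᵗ_

  data _∈ᵗ_ (x : Fin N) : Tree {N} → Set where
    at-leaf  : x ∈ᵗ leaf x
    in-left  : ∀ {l r} → x ∈ᵗ l → x ∈ᵗ node l r
    in-right : ∀ {l r} → x ∈ᵗ r → x ∈ᵗ node l r

  Disjointᵗ : Tree {N} → Tree {N} → Set
  Disjointᵗ l r = ∀ x → x ∈ᵗ l → ¬ x ∈ᵗ r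

  Distinct : Tree {N} → Set
  Distinct (leaf _)   = ⊤
  Distinct (node l r) = Distinct l × Distinct r × Disjointᵗ l r

  ∈ᵗ-leaf⁻ : ∀ {x y} → y ∈ᵗ leaf x → y ≡ x
  ∈ᵗ-leaf⁻ at-leaf = refl

  _∈ᵗ?_ : ∀ x t → Dec (x ∈ᵗ t)
  x ∈ᵗ? leaf y   = map′ (λ { refl → at-leaf }) ∈ᵗ-leaf⁻ (x ≟ y)
  x ∈ᵗ? node l r = map′ [ in-left , in-right ] (λ { (in-left x∈) → inj₁ x∈ ; (in-right x∈) → inj₂ x∈ })
                        ((x ∈ᵗ? l) ⊎-dec (x ∈ᵗ? r))

  some-leaf : ∀ t → ∃ λ x → x ∈ᵗ t
  some-leaf (leaf x)   = x , at-leaf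
  some-leaf (node l r) = let x , x∈l = some-leaf l in x , in-left x∈l

  ∈ᵗ⇒∈-leaves : ∀ {x t} → x ∈ᵗ t → x ∈ leaves t
  ∈ᵗ⇒∈-leaves at-leaf                       = here refl
  ∈ᵗ⇒∈-leaves             (in-left x∈l)     = ∈-++⁺ˡ (∈ᵗ⇒∈-leaves x∈l)
  ∈ᵗ⇒∈-leaves {t = node l _} (in-right x∈r) = ∈-++⁺ʳ (leaves l) (∈ᵗ⇒∈-leaves x∈r)

  ∈-leaves⇒∈ᵗ : ∀ {x} t → x ∈ leaves t → x ∈ᵗ t
  ∈-leaves⇒∈ᵗ (leaf _) (here refl) = at-leaf
  ∈-leaves⇒∈ᵗ (node l r) x∈ with ∈-++⁻ (leaves l) x∈
  ... | inj₁ x∈l = in-left  (∈-leaves⇒∈ᵗ l x∈l)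
  ... | inj₂ x∈r = in-right (∈-leaves⇒∈ᵗ r x∈r)

  Unique-++⁻ : ∀ (xs : List (Fin N)) {ys} → Unique (xs ++ ys) →
               Unique xs × Unique ys × (∀ {x} → x ∈ xs → ¬ x ∈ ys)
  Unique-++⁻ []       ys!        = [] , ys! , λ ()
  Unique-++⁻ (x ∷ xs) (x∉ ∷ xs!) =
    let xs! , ys! , xs#ys = Unique-++⁻ xs xs!
        x∉xs , x∉ys       = Allₚ.++⁻ xs x∉
    in x∉xs ∷ xs! , ys! , λ { (here refl) y∈ys → All.lookup x∉ys y∈ys refl
                            ; (there y∈xs)      → xs#ys y∈xs }

  Unique⇒Distinct : ∀ t → Unique (leaves t) → Distinct t
  Unique⇒Distinct (leaf _)   _ = tt
  Unique⇒Distinct (node l r) ! =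
    let l! , r! , l#r = Unique-++⁻ (leaves l) ! in
    Unique⇒Distinct l l! , Unique⇒Distinct r r! ,
    λ x x∈l x∈r → l#r (∈ᵗ⇒∈-leaves x∈l) (∈ᵗ⇒∈-leaves x∈r)

  Distinct⇒Unique : ∀ t → Distinct t → Unique (leaves t)
  Distinct⇒Unique (leaf _)   _               = [] ∷ []
  Distinct⇒Unique (node l r) (dl , dr , l#r) =
    Unique.++⁺ (Distinct⇒Unique l dl) (Distinct⇒Unique r dr)
      λ (x∈l , x∈r) → l#r _ (∈-leaves⇒∈ᵗ l x∈l) (∈-leaves⇒∈ᵗ r x∈r)

  ≅-refl : ∀ (t : Tree {N}) → t ≅ t
  ≅-refl (leaf a)   = leaf≅ a
  ≅-refl (node l r) = straight (≅-refl l) (≅-refl r)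

  ≅-sym : ∀ {t u : Tree {N}} → t ≅ u → u ≅ t
  ≅-sym (leaf≅ a)      = leaf≅ a
  ≅-sym (straight i j) = straight (≅-sym i) (≅-sym j)
  ≅-sym (cross i j)    = cross (≅-sym j) (≅-sym i)

  ≅-trans : ∀ {t u v : Tree {N}} → t ≅ u → u ≅ v → t ≅ v
  ≅-trans (leaf≅ a)      (leaf≅ .a)     = leaf≅ a
  ≅-trans (straight i j) (straight k l) = straight (≅-trans i k) (≅-trans j l)
  ≅-trans (straight i j) (cross k l)    = cross (≅-trans i k) (≅-trans j l)
  ≅-trans (cross i j)    (straight k l) = cross (≅-trans i l) (≅-trans j k)
  ≅-trans (cross i j)    (cross k l)    = straight (≅-trans i l) (≅-trans j k)

  ∈ᵗ-resp-≅ : ∀ {x} {t u : Tree {N}} → t ≅ u → x ∈ᵗ t → x ∈ᵗ u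
  ∈ᵗ-resp-≅ (leaf≅ _)      x∈          = x∈
  ∈ᵗ-resp-≅ (straight i _) (in-left x∈)  = in-left  (∈ᵗ-resp-≅ i x∈)
  ∈ᵗ-resp-≅ (straight _ j) (in-right x∈) = in-right (∈ᵗ-resp-≅ j x∈)
  ∈ᵗ-resp-≅ (cross i _)    (in-left x∈)  = in-right (∈ᵗ-resp-≅ i x∈)
  ∈ᵗ-resp-≅ (cross _ j)    (in-right x∈) = in-left  (∈ᵗ-resp-≅ j x∈)

  does-∈ᵗ?-≅ : ∀ {x} {t u : Tree {N}} → t ≅ u → does (x ∈ᵗ? t) ≡ does (x ∈ᵗ? u)
  does-∈ᵗ?-≅ i = does-⇔ (mk⇔ (∈ᵗ-resp-≅ i) (∈ᵗ-resp-≅ (≅-sym i))) (_ ∈ᵗ? _) (_ ∈ᵗ? _)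

  Distinct⇒children-≇ : ∀ {l r : Tree {N}} → Distinct (node l r) → ¬ l ≅ r
  Distinct⇒children-≇ {l} (_ , _ , l#r) l≅r =
    let x , x∈l = some-leaf l in l#r x x∈l (∈ᵗ-resp-≅ l≅r x∈l)

  rename : (Fin N → Fin N) → Tree {N} → Tree {N}
  rename f (leaf a)   = leaf (f a)
  rename f (node l r) = node (rename f l) (rename f r)

  relabel≡rename : ∀ σ t → relabel σ t ≡ rename (σ ⟨$⟩ʳ_) t
  relabel≡rename σ (leaf a)   = refl
  relabel≡rename σ (node l r) = cong₂ node (relabel≡rename σ l) (relabel≡rename σ r)

  rename-≅ : ∀ f {t u} → t ≅ u → rename f t ≅ rename f u
  rename-≅ f (leaf≅ a)      = leaf≅ (f a)
  rename-≅ f (straight i j) = straight (rename-≅ f i) (rename-≅ f j)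
  rename-≅ f (cross i j)    = cross (rename-≅ f i) (rename-≅ f j)

  rename-∘ : ∀ f g t → rename f (rename g t) ≡ rename (f ∘ g) t
  rename-∘ f g (leaf a)   = refl
  rename-∘ f g (node l r) = cong₂ node (rename-∘ f g l) (rename-∘ f g r)

  ∈ᵗ-rename⁺ : ∀ f {x t} → x ∈ᵗ t → f x ∈ᵗ rename f t
  ∈ᵗ-rename⁺ f at-leaf       = at-leaf
  ∈ᵗ-rename⁺ f (in-left x∈)  = in-left  (∈ᵗ-rename⁺ f x∈)
  ∈ᵗ-rename⁺ f (in-right x∈) = in-right (∈ᵗ-rename⁺ f x∈)

  ∈ᵗ-rename⁻ : ∀ f {y} t → y ∈ᵗ rename f t → ∃ λ x → x ∈ᵗ t × f x ≡ y
  ∈ᵗ-rename⁻ f (leaf a)   at-leaf       = a , at-leaf , refl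
  ∈ᵗ-rename⁻ f (node l r) (in-left y∈)  = let x , x∈ , fx≡y = ∈ᵗ-rename⁻ f l y∈ in x , in-left x∈ , fx≡y
  ∈ᵗ-rename⁻ f (node l r) (in-right y∈) = let x , x∈ , fx≡y = ∈ᵗ-rename⁻ f r y∈ in x , in-right x∈ , fx≡y

  Distinct-rename : ∀ f → (∀ {x y} → f x ≡ f y → x ≡ y) → ∀ t → Distinct t → Distinct (rename f t)
  Distinct-rename f f-inj (leaf _)   _               = tt
  Distinct-rename f f-inj (node l r) (dl , dr , l#r) =
    Distinct-rename f f-inj l dl , Distinct-rename f f-inj r dr , disjoint
    where
      disjoint : Disjointᵗ (rename f l) (rename f r)
      disjoint y y∈l y∈r with ∈ᵗ-rename⁻ f l y∈l | ∈ᵗ-rename⁻ f r y∈r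
      ... | x , x∈l , refl | x′ , x′∈r , fx′≡fx with f-inj fx′≡fx
      ... | refl = l#r x x∈l x′∈r

-- Edges addressed by their path from the root-edge.  Unlike `Edge t` this does not depend on the
-- tree, so the edge of a pruned tree can be located before that tree is known.
data Path : Set where
  root        : Path
  left right  : Path → Path

module _ {N : ℕ} where

  PathIn : Tree {N} → Path → Set
  PathIn t          root      = ⊤
  PathIn (leaf _)   (left _)  = ⊥
  PathIn (leaf _)   (right _) = ⊥
  PathIn (node l r) (left p)  = PathIn l p
  PathIn (node l r) (right p) = PathIn r p

  pathOf : ∀ {t : Tree {N}} → Edge t → Path
  pathOf here    = root
  pathOf (inl e) = left (pathOf e)
  pathOf (inr e) = right (pathOf e)

  PathIn-pathOf : ∀ {t : Tree {N}} (e : Edge t) → PathIn t (pathOf e)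
  PathIn-pathOf here                 = tt
  PathIn-pathOf {node l r} (inl e) = PathIn-pathOf e
  PathIn-pathOf {node l r} (inr e) = PathIn-pathOf e

  edgeAt : ∀ (t : Tree {N}) p → PathIn t p → Edge t
  edgeAt t          root      _  = here
  edgeAt (node l r) (left p)  ok = inl (edgeAt l p ok)
  edgeAt (node l r) (right p) ok = inr (edgeAt r p ok)

  pathOf-edgeAt : ∀ (t : Tree {N}) p ok → pathOf (edgeAt t p ok) ≡ p
  pathOf-edgeAt t          root      _  = refl
  pathOf-edgeAt (node l r) (left p)  ok = cong left (pathOf-edgeAt l p ok)
  pathOf-edgeAt (node l r) (right p) ok = cong right (pathOf-edgeAt r p ok)

  pathOf-injective : ∀ {t : Tree {N}} (e e′ : Edge t) → pathOf e ≡ pathOf e′ → e ≡ e′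
  pathOf-injective here    here     _    = refl
  pathOf-injective (inl e) (inl e′) eq   = cong inl (pathOf-injective e e′ (left-injective eq))
    where left-injective : ∀ {p q} → left p ≡ left q → p ≡ q
          left-injective refl = refl
  pathOf-injective (inr e) (inr e′) eq   = cong inr (pathOf-injective e e′ (right-injective eq))
    where right-injective : ∀ {p q} → right p ≡ right q → p ≡ q
          right-injective refl = refl
  pathOf-injective here    (inl _)  ()
  pathOf-injective here    (inr _)  ()
  pathOf-injective (inl _) here     ()
  pathOf-injective (inl _) (inr _)  ()
  pathOf-injective (inr _) here     ()
  pathOf-injective (inr _) (inl _)  ()

  transportPath : ∀ {t u : Tree {N}} → t ≅ u → Path → Path
  transportPath _              root      = root
  transportPath (leaf≅ _)      p         = p
  transportPath (straight i _) (left p)  = left (transportPath i p)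
  transportPath (straight _ j) (right p) = right (transportPath j p)
  transportPath (cross i _)    (left p)  = right (transportPath i p)
  transportPath (cross _ j)    (right p) = left (transportPath j p)

  pathOf-transport : ∀ {t u : Tree {N}} (i : t ≅ u) (e : Edge t) →
                     pathOf (transport i e) ≡ transportPath i (pathOf e)
  pathOf-transport (leaf≅ _)      here    = refl
  pathOf-transport (straight _ _) here    = refl
  pathOf-transport (straight i _) (inl e) = cong left (pathOf-transport i e)
  pathOf-transport (straight _ j) (inr e) = cong right (pathOf-transport j e)
  pathOf-transport (cross _ _)    here    = refl
  pathOf-transport (cross i _)    (inl e) = cong right (pathOf-transport i e)
  pathOf-transport (cross _ j)    (inr e) = cong left (pathOf-transport j e)

  transport-by-path : ∀ {t u : Tree {N}} (i : t ≅ u) (e : Edge t) (e′ : Edge u) →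
                      transportPath i (pathOf e) ≡ pathOf e′ → transport i e ≡ e′
  transport-by-path i e e′ eq = pathOf-injective (transport i e) e′ (trans (pathOf-transport i e) eq)

-- Orbits of a permutation of 2-power order

2*-suc : ∀ k → 2 * suc k ≡ suc (suc (2 * k))
2*-suc = solve-∀

parity : ∀ i → ∃ λ j → i ≡ 2 * j ⊎ i ≡ suc (2 * j)
parity zero    = 0 , inj₁ refl
parity (suc i) with parity i
... | j , inj₁ refl = j , inj₂ refl
... | j , inj₂ refl = suc j , inj₁ (sym (2*-suc j))

1+2*-mono-< : ∀ {i M} → i < M → suc (2 * i) < 2 * M
1+2*-mono-< {i} {M} i<M = subst (_≤ 2 * M) (2*-suc i) (*-monoʳ-≤ 2 i<M)

module _ {N : ℕ} where

  iterate : (Fin N → Fin N) → ℕ → Fin N → Fin N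
  iterate f zero    x = x
  iterate f (suc k) x = f (iterate f k x)

  iter≡iterate : ∀ σ k x → iter σ k x ≡ iterate (σ ⟨$⟩ʳ_) k x
  iter≡iterate σ zero    x = refl
  iter≡iterate σ (suc k) x = cong (σ ⟨$⟩ʳ_) (iter≡iterate σ k x)

  iterate-+ : ∀ f i j x → iterate f (i + j) x ≡ iterate f i (iterate f j x)
  iterate-+ f zero    j x = refl
  iterate-+ f (suc i) j x = cong f (iterate-+ f i j x)

  iterate-comm : ∀ f i j x → iterate f i (iterate f j x) ≡ iterate f j (iterate f i x)
  iterate-comm f i j x = begin
    iterate f i (iterate f j x) ≡⟨ iterate-+ f i j x ⟨
    iterate f (i + j) x         ≡⟨ cong (λ n → iterate f n x) (+-comm i j) ⟩
    iterate f (j + i) x         ≡⟨ iterate-+ f j i x ⟩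
    iterate f j (iterate f i x) ∎
    where open ≡-Reasoning

  iterate-suc′ : ∀ f k x → iterate f k (f x) ≡ iterate f (suc k) x
  iterate-suc′ f zero    x = refl
  iterate-suc′ f (suc k) x = cong f (iterate-suc′ f k x)

  iterate-injective : ∀ f → (∀ {x y} → f x ≡ f y → x ≡ y) →
                      ∀ k {x y} → iterate f k x ≡ iterate f k y → x ≡ y
  iterate-injective f f-inj zero    eq = eq
  iterate-injective f f-inj (suc k) eq = iterate-injective f f-inj k (f-inj eq)

  twice : (Fin N → Fin N) → Fin N → Fin N
  twice f = f ∘ f

  iterate-twice : ∀ f k x → iterate (twice f) k x ≡ iterate f (2 * k) x
  iterate-twice f zero    x = refl
  iterate-twice f (suc k) x =
    trans (cong (twice f) (iterate-twice f k x)) (cong (λ n → iterate f n x) (sym (2*-suc k)))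

  iterate-periodic : ∀ f {P a} → iterate f P a ≡ a → ∀ q → iterate f (q * P) a ≡ a
  iterate-periodic f         e zero    = refl
  iterate-periodic f {P} {a} e (suc q) =
    trans (iterate-+ f P (q * P) a) (trans (cong (iterate f P) (iterate-periodic f e q)) e)

  iterate-% : ∀ f P .{{_ : NonZero P}} {a} → iterate f P a ≡ a → ∀ k → iterate f k a ≡ iterate f (k % P) a
  iterate-% f P {a} e k = begin
    iterate f k a                                 ≡⟨ cong (λ n → iterate f n a) (m≡m%n+[m/n]*n k P) ⟩
    iterate f (k % P + k / P * P) a               ≡⟨ iterate-+ f (k % P) (k / P * P) a ⟩
    iterate f (k % P) (iterate f (k / P * P) a)   ≡⟨ cong (iterate f (k % P)) (iterate-periodic f e (k / P)) ⟩
    iterate f (k % P) a                           ∎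
    where open ≡-Reasoning

  InOrbit : (Fin N → Fin N) → Fin N → Fin N → Set
  InOrbit f a x = ∃ λ k → iterate f k a ≡ x

  InOrbit-trans : ∀ {f a x y} → InOrbit f a x → InOrbit f x y → InOrbit f a y
  InOrbit-trans {f} {a} (i , refl) (j , refl) = j + i , iterate-+ f j i a

  InOrbit-periodic : ∀ {f P a x} → iterate f P a ≡ a → InOrbit f a x → iterate f P x ≡ x
  InOrbit-periodic {f} {P} {a} returns (k , refl) = trans (iterate-comm f P k a) (cong (iterate f k) returns)

  InOrbitBelow : (Fin N → Fin N) → Fin N → ℕ → Fin N → Set
  InOrbitBelow f a K x = ∃ λ k → k < K × iterate f k a ≡ x

  InjectiveBelow : (Fin N → Fin N) → Fin N → ℕ → Set
  InjectiveBelow f a K = ∀ {i j} → i < K → j < K → iterate f i a ≡ iterate f j a → i ≡ j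

  InOrbitBelow? : ∀ f a K x → Dec (InOrbitBelow f a K x)
  InOrbitBelow? f a K x = anyUpTo? (λ k → iterate f k a ≟ x) K

  -- The situation of a maximal cycle through a in a binary cycle type.
  record PowerCycle (τ : Fin N → Fin N) (m : ℕ) (a : Fin N) : Set where
    field
      injective : ∀ {x y} → τ x ≡ τ y → x ≡ y
      periodic  : ∀ x → iterate τ (2 ^ m) x ≡ x
      exact-period : ∀ i → 1 ≤ i → i < 2 ^ m → iterate τ i a ≢ a
  open PowerCycle public

  PowerCycle-twice : ∀ {τ m a} → PowerCycle τ (suc m) a → PowerCycle (twice τ) m a
  PowerCycle-twice {τ} {m} {a} G = record
    { injective = injective G ∘ injective G
    ; periodic  = λ x → trans (iterate-twice τ (2 ^ m) x) (periodic G x)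
    ; exact-period = λ i 1≤i i<2^m eq →
        exact-period G (2 * i) (≤-trans 1≤i (m≤m+n i (i + 0))) (*-monoʳ-< 2 i<2^m)
          (trans (sym (iterate-twice τ i a)) eq)
    }

  -- Boolean so that it can serve as the deletion test of `prune`.
  inOrbitᵇ : (Fin N → Fin N) → ℕ → Fin N → Fin N → Bool
  inOrbitᵇ τ m a x = does (InOrbitBelow? τ a (2 ^ m) x)

  InOrbitBelow⇒InOrbit : ∀ {f a K x} → InOrbitBelow f a K x → InOrbit f a x
  InOrbitBelow⇒InOrbit (k , _ , eq) = k , eq

  inOrbitᵇ-sound : ∀ {τ m a x} → inOrbitᵇ τ m a x ≡ true → InOrbit τ a x
  inOrbitᵇ-sound {τ} {m} {a} {x} e with InOrbitBelow? τ a (2 ^ m) x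
  ... | yes below = InOrbitBelow⇒InOrbit below

  inOrbitᵇ-false : ∀ {τ m a x} → ¬ InOrbit τ a x → inOrbitᵇ τ m a x ≡ false
  inOrbitᵇ-false {τ} {m} {a} {x} ∉orbit = dec-false (InOrbitBelow? τ a (2 ^ m) x) (∉orbit ∘ InOrbitBelow⇒InOrbit)

  InOrbit-step : ∀ {τ a x} → InOrbit τ a x → InOrbit τ a (τ x)
  InOrbit-step {τ} (k , eq) = suc k , cong τ eq

  module _ {τ m a} (G : PowerCycle τ m a) where

    private instance
      2^m-nonZero : NonZero (2 ^ m)
      2^m-nonZero = m^n≢0 2 m

    iterate-%-period : ∀ k → iterate τ k a ≡ iterate τ (k % 2 ^ m) a
    iterate-%-period = iterate-% τ (2 ^ m) (periodic G a)

    InOrbit⇒InOrbitBelow : ∀ {x} → InOrbit τ a x → InOrbitBelow τ a (2 ^ m) x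
    InOrbit⇒InOrbitBelow (k , eq) = k % 2 ^ m , m%n<n k (2 ^ m) , trans (sym (iterate-%-period k)) eq

    InOrbit? : ∀ x → Dec (InOrbit τ a x)
    InOrbit? x = map′ InOrbitBelow⇒InOrbit InOrbit⇒InOrbitBelow (InOrbitBelow? τ a (2 ^ m) x)

    inOrbitᵇ-complete : ∀ {x} → InOrbit τ a x → inOrbitᵇ τ m a x ≡ true
    inOrbitᵇ-complete {x} (k , eq) =
      dec-true (InOrbitBelow? τ a (2 ^ m) x) (InOrbit⇒InOrbitBelow (k , eq))

    inOrbitᵇ-self : inOrbitᵇ τ m a a ≡ true
    inOrbitᵇ-self = inOrbitᵇ-complete (0 , refl)

    InOrbit-step⁻ : ∀ {x} → InOrbit τ a (τ x) → InOrbit τ a x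
    InOrbit-step⁻ (suc k , eq) = k , injective G eq
    InOrbit-step⁻ (zero  , eq) = 2 ^ m ∸ 1 , injective G (begin
      τ (iterate τ (2 ^ m ∸ 1) a)   ≡⟨ iterate-+ τ 1 (2 ^ m ∸ 1) a ⟨
      iterate τ (1 + (2 ^ m ∸ 1)) a ≡⟨ cong (λ n → iterate τ n a) (m+[n∸m]≡n (m^n>0 2 m)) ⟩
      iterate τ (2 ^ m) a           ≡⟨ periodic G a ⟩
      a                             ≡⟨ eq ⟩
      _                             ∎)
      where open ≡-Reasoning

    InOrbit-sym : ∀ {x} → InOrbit τ a x → InOrbit τ x a
    InOrbit-sym {x} (k , refl) = 2 ^ m ∸ k % 2 ^ m , (begin
      iterate τ (2 ^ m ∸ r) (iterate τ k a)   ≡⟨ cong (iterate τ (2 ^ m ∸ r)) (iterate-%-period k) ⟩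
      iterate τ (2 ^ m ∸ r) (iterate τ r a)   ≡⟨ iterate-+ τ (2 ^ m ∸ r) r a ⟨
      iterate τ (2 ^ m ∸ r + r) a             ≡⟨ cong (λ n → iterate τ n a) (m∸n+n≡m (<⇒≤ (m%n<n k (2 ^ m)))) ⟩
      iterate τ (2 ^ m) a                     ≡⟨ periodic G a ⟩
      a                                       ∎)
      where
        open ≡-Reasoning
        r : ℕ
        r = k % 2 ^ m

    returns-early : ∀ {i j} → i < j → j < 2 ^ m → iterate τ i a ≢ iterate τ j a
    returns-early {i} {j} i<j j< eq =
      exact-period G (j ∸ i) (m<n⇒0<n∸m i<j) (≤-<-trans (m∸n≤m j i) j<)
        (iterate-injective τ (injective G) i (begin
          iterate τ i (iterate τ (j ∸ i) a) ≡⟨ iterate-+ τ i (j ∸ i) a ⟨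
          iterate τ (i + (j ∸ i)) a         ≡⟨ cong (λ n → iterate τ n a) (m+[n∸m]≡n (<⇒≤ i<j)) ⟩
          iterate τ j a                     ≡⟨ eq ⟨
          iterate τ i a                     ∎))
      where open ≡-Reasoning

    iterate-injective-below : InjectiveBelow τ a (2 ^ m)
    iterate-injective-below {i} {j} i< j< eq with <-cmp i j
    ... | tri≈ _ i≡j _ = i≡j
    ... | tri< i<j _ _ = ⊥-elim (returns-early i<j j< eq)
    ... | tri> _ _ j<i = ⊥-elim (returns-early j<i i< (sym eq))

    iterate-≡⇒%-≡ : ∀ {i j} → iterate τ i a ≡ iterate τ j a → i % 2 ^ m ≡ j % 2 ^ m
    iterate-≡⇒%-≡ {i} {j} eq =
      iterate-injective-below (m%n<n i (2 ^ m)) (m%n<n j (2 ^ m))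
        (trans (sym (iterate-%-period i)) (trans eq (iterate-%-period j)))

  inOrbitᵇ-cong : ∀ {τ m a τ′ m′ a′} → PowerCycle τ m a → PowerCycle τ′ m′ a′ → ∀ {x x′} →
                  (InOrbit τ a x → InOrbit τ′ a′ x′) → (InOrbit τ′ a′ x′ → InOrbit τ a x) →
                  inOrbitᵇ τ m a x ≡ inOrbitᵇ τ′ m′ a′ x′
  inOrbitᵇ-cong G G′ to from =
    does-⇔ (mk⇔ (InOrbit⇒InOrbitBelow G′ ∘ to ∘ InOrbitBelow⇒InOrbit) (InOrbit⇒InOrbitBelow G ∘ from ∘ InOrbitBelow⇒InOrbit))
           (InOrbitBelow? _ _ _ _) (InOrbitBelow? _ _ _ _)

  inOrbitᵇ-step : ∀ {τ m a} → PowerCycle τ m a → ∀ x → inOrbitᵇ τ m a (τ x) ≡ inOrbitᵇ τ m a x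
  inOrbitᵇ-step G x = inOrbitᵇ-cong G G (InOrbit-step⁻ G) InOrbit-step

  even≢odd-iterate : ∀ {τ m a} → PowerCycle τ (suc m) a →
                     ∀ i j → iterate τ (2 * i) a ≢ iterate τ (suc (2 * j)) a
  even≢odd-iterate {m = m} G i j eq = 0≢1 (begin
    0                              ≡⟨ even%2 i ⟨
    2 * i % 2                      ≡⟨ m∣n⇒o%n%m≡o%m 2 (2 ^ suc m) (2 * i) 2∣2^1+m ⟨
    2 * i % 2 ^ suc m % 2          ≡⟨ cong (_% 2) (iterate-≡⇒%-≡ G eq) ⟩
    suc (2 * j) % 2 ^ suc m % 2    ≡⟨ m∣n⇒o%n%m≡o%m 2 (2 ^ suc m) (suc (2 * j)) 2∣2^1+m ⟩
    suc (2 * j) % 2                ≡⟨ odd%2 j ⟩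
    1                              ∎)
    where
      open ≡-Reasoning
      instance
        2^1+m-nonZero : NonZero (2 ^ suc m)
        2^1+m-nonZero = m^n≢0 2 (suc m)
      2∣2^1+m : 2 ∣ 2 ^ suc m
      2∣2^1+m = divides (2 ^ m) (*-comm 2 (2 ^ m))
      even%2 : ∀ i → 2 * i % 2 ≡ 0
      even%2 i = trans (cong (_% 2) (*-comm 2 i)) (m*n%n≡0 i 2)
      odd%2 : ∀ j → suc (2 * j) % 2 ≡ 1
      odd%2 j = trans (cong (λ n → suc n % 2) (*-comm 2 j)) ([m+kn]%n≡m%n 1 j 2)
      0≢1 : 0 ≢ 1
      0≢1 ()

-- The cycle tree

module _ {N : ℕ} where

  iterate-twice-suc : ∀ (g : Fin N → Fin N) i x → iterate (twice g) i (g x) ≡ iterate g (suc (2 * i)) x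
  iterate-twice-suc g i x = trans (iterate-twice g i (g x)) (iterate-suc′ g (2 * i) x)

  -- Leaves g^i x for i < 2^k: the even powers on the left, the odd ones on the right.
  cycleTree : (Fin N → Fin N) → ℕ → Fin N → Tree {N}
  cycleTree g zero    x = leaf x
  cycleTree g (suc k) x = node (cycleTree (twice g) k x) (cycleTree (twice g) k (g x))

  ∈ᵗ-cycleTree⁺ : ∀ g k x {i} → i < 2 ^ k → iterate g i x ∈ᵗ cycleTree g k x
  ∈ᵗ-cycleTree⁺ g zero    x {zero}  _        = at-leaf
  ∈ᵗ-cycleTree⁺ g zero    x {suc i} (s≤s ())
  ∈ᵗ-cycleTree⁺ g (suc k) x {i} i< with parity i
  ... | j , inj₁ refl = in-left (subst (_∈ᵗ _) (iterate-twice g j x)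
                          (∈ᵗ-cycleTree⁺ (twice g) k x (*-cancelˡ-< 2 j (2 ^ k) i<)))
  ... | j , inj₂ refl = in-right (subst (_∈ᵗ _) (iterate-twice-suc g j x)
                          (∈ᵗ-cycleTree⁺ (twice g) k (g x) (*-cancelˡ-< 2 j (2 ^ k) (<-trans (n<1+n _) i<))))

  ∈ᵗ-cycleTree⁻ : ∀ g k x {y} → y ∈ᵗ cycleTree g k x → InOrbitBelow g x (2 ^ k) y
  ∈ᵗ-cycleTree⁻ g zero    x at-leaf = 0 , s≤s z≤n , refl
  ∈ᵗ-cycleTree⁻ g (suc k) x (in-left y∈) =
    let i , i< , eq = ∈ᵗ-cycleTree⁻ (twice g) k x y∈
    in 2 * i , *-monoʳ-< 2 i< , trans (sym (iterate-twice g i x)) eq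
  ∈ᵗ-cycleTree⁻ g (suc k) x (in-right y∈) =
    let i , i< , eq = ∈ᵗ-cycleTree⁻ (twice g) k (g x) y∈
    in suc (2 * i) , 1+2*-mono-< i< , trans (sym (iterate-twice-suc g i x)) eq

  rename-cycleTree : ∀ f g → (∀ y → f (g y) ≡ g (f y)) → ∀ k x → rename f (cycleTree g k x) ≡ cycleTree g k (f x)
  rename-cycleTree f g fg≡gf zero    x = refl
  rename-cycleTree f g fg≡gf (suc k) x =
    cong₂ node (rename-cycleTree f (twice g) ftwice≡twicef k x)
               (trans (rename-cycleTree f (twice g) ftwice≡twicef k (g x)) (cong (cycleTree (twice g) k) (fg≡gf x)))
    where
      ftwice≡twicef : ∀ y → f (twice g y) ≡ twice g (f y)
      ftwice≡twicef y = trans (fg≡gf (g y)) (cong g (fg≡gf y))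

  cycleTree-invariant : ∀ g k x → iterate g (2 ^ k) x ≡ x → rename g (cycleTree g k x) ≅ cycleTree g k x
  cycleTree-invariant g zero    x eq = subst (λ z → leaf z ≅ leaf x) (sym eq) (leaf≅ x)
  cycleTree-invariant g (suc k) x eq
    rewrite rename-cycleTree g (twice g) (λ _ → refl) k x | rename-cycleTree g (twice g) (λ _ → refl) k (g x) =
    cross (≅-refl _)
          (subst (_≅ cycleTree (twice g) k x) (rename-cycleTree (twice g) (twice g) (λ _ → refl) k x)
                 (cycleTree-invariant (twice g) k x (trans (iterate-twice g (2 ^ k) x) eq)))

  Distinct-cycleTree : ∀ g k x → InjectiveBelow g x (2 ^ k) → Distinct (cycleTree g k x)
  Distinct-cycleTree g zero    x inj = tt
  Distinct-cycleTree g (suc k) x inj =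
    Distinct-cycleTree (twice g) k x inj-even , Distinct-cycleTree (twice g) k (g x) inj-odd , even#odd
    where
      inj-even : InjectiveBelow (twice g) x (2 ^ k)
      inj-even {i} {j} i< j< eq = *-cancelˡ-≡ i j 2 (inj (*-monoʳ-< 2 i<) (*-monoʳ-< 2 j<)
                            (trans (sym (iterate-twice g i x)) (trans eq (iterate-twice g j x))))
      inj-odd : InjectiveBelow (twice g) (g x) (2 ^ k)
      inj-odd {i} {j} i< j< eq = *-cancelˡ-≡ i j 2 (suc-injective (inj (1+2*-mono-< i<) (1+2*-mono-< j<)
                            (trans (sym (iterate-twice-suc g i x)) (trans eq (iterate-twice-suc g j x)))))
      even#odd : Disjointᵗ (cycleTree (twice g) k x) (cycleTree (twice g) k (g x))
      even#odd y y∈l y∈r =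
        let i , i< , eqᵢ = ∈ᵗ-cycleTree⁻ (twice g) k x y∈l
            j , j< , eqⱼ = ∈ᵗ-cycleTree⁻ (twice g) k (g x) y∈r
        in even≢odd i j (inj (*-monoʳ-< 2 i<) (1+2*-mono-< j<)
             (trans (sym (iterate-twice g i x)) (trans eqᵢ (trans (sym eqⱼ) (iterate-twice-suc g j x)))))

module _ {N : ℕ} {τ : Fin N → Fin N} where

  ∈ᵗ-step : ∀ {l r : Tree {N}} → rename τ l ≅ r → ∀ {x} → x ∈ᵗ l → τ x ∈ᵗ r
  ∈ᵗ-step w x∈ = ∈ᵗ-resp-≅ w (∈ᵗ-rename⁺ τ x∈)

  ∈ᵗ-step⁻ : ∀ {l r : Tree {N}} → rename τ l ≅ r → ∀ {y} → y ∈ᵗ r → ∃ λ x → x ∈ᵗ l × τ x ≡ y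
  ∈ᵗ-step⁻ {l} w y∈ = ∈ᵗ-rename⁻ τ l (∈ᵗ-resp-≅ (≅-sym w) y∈)

  ∈ᵗ-iterate : ∀ {s : Tree {N}} → rename τ s ≅ s → ∀ {x} k → x ∈ᵗ s → iterate τ k x ∈ᵗ s
  ∈ᵗ-iterate w zero    x∈ = x∈
  ∈ᵗ-iterate w (suc k) x∈ = ∈ᵗ-step w (∈ᵗ-iterate w k x∈)

  InOrbit⇒∈ᵗ : ∀ {s : Tree {N}} → rename τ s ≅ s → ∀ {a x} → a ∈ᵗ s → InOrbit τ a x → x ∈ᵗ s
  InOrbit⇒∈ᵗ w a∈ (k , refl) = ∈ᵗ-iterate w k a∈

  rename-twice-≅ : ∀ {l r : Tree {N}} → rename τ l ≅ r → rename τ r ≅ l → rename (twice τ) l ≅ l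
  rename-twice-≅ {l} wl wr = subst (_≅ l) (rename-∘ τ τ l) (≅-trans (rename-≅ τ wl) wr)

  rename²-≅ : ∀ (t : Tree {N}) → rename (twice τ) t ≅ t → rename τ (rename τ t) ≅ t
  rename²-≅ t = subst (_≅ t) (sym (rename-∘ τ τ t))

  module _ {l r : Tree {N}} (wl : rename τ l ≅ r) (wr : rename τ r ≅ l) {a} (a∈l : a ∈ᵗ l) where

    ∈ᵗ-alternate : ∀ k → iterate τ (2 * k) a ∈ᵗ l × iterate τ (suc (2 * k)) a ∈ᵗ r
    ∈ᵗ-alternate zero    = a∈l , ∈ᵗ-step wl a∈l
    ∈ᵗ-alternate (suc k) =
      let even = ∈ᵗ-step wr (proj₂ (∈ᵗ-alternate k))
      in subst (_∈ᵗ l) (cong (λ n → iterate τ n a) (sym (2*-suc k))) even ,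
         subst (_∈ᵗ r) (cong (λ n → iterate τ (suc n) a) (sym (2*-suc k))) (∈ᵗ-step wl even)

    InOrbit-twice⇒∈ᵗ : ∀ {x} → InOrbit (twice τ) a x → x ∈ᵗ l
    InOrbit-twice⇒∈ᵗ (j , refl) = subst (_∈ᵗ l) (sym (iterate-twice τ j a)) (proj₁ (∈ᵗ-alternate j))

    InOrbit⇒InOrbit-twice : Disjointᵗ l r → ∀ {x} → x ∈ᵗ l → InOrbit τ a x → InOrbit (twice τ) a x
    InOrbit⇒InOrbit-twice l#r {x} x∈l (k , refl) with parity k
    ... | j , inj₁ refl = j , iterate-twice τ j a
    ... | j , inj₂ refl with () ← l#r _ x∈l (proj₂ (∈ᵗ-alternate j))

  InOrbit-twice⇒InOrbit : ∀ {a x} → InOrbit (twice τ) a x → InOrbit τ a x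
  InOrbit-twice⇒InOrbit {a} (j , eq) = 2 * j , trans (sym (iterate-twice τ j a)) eq

  swap⇒exponent-suc : ∀ {m a} {l r : Tree {N}} → PowerCycle τ m a → Disjointᵗ l r → rename τ l ≅ r →
                      ∃ λ m′ → m ≡ suc m′
  swap⇒exponent-suc {zero} {l = l} G l#r wl with some-leaf l
  ... | y , y∈l with () ← l#r y y∈l (subst (_∈ᵗ _) (periodic G y) (∈ᵗ-step wl y∈l))
  swap⇒exponent-suc {suc m} G l#r wl = m , refl

module _ {N : ℕ} where

  InOrbit-closed : ∀ {τ m a} → PowerCycle τ m a → ∀ {s : Tree {N}} → rename τ s ≅ s →
                   ∀ {y} → y ∈ᵗ s → InOrbit τ a y → a ∈ᵗ s
  InOrbit-closed G {s} w y∈ y∈orbit =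
    let k , eq = InOrbit-sym G y∈orbit in subst (_∈ᵗ s) eq (∈ᵗ-iterate w k y∈)

  rename-cycleTree-twice : ∀ (τ : Fin N → Fin N) k x → rename τ (cycleTree (twice τ) k x) ≡ cycleTree (twice τ) k (τ x)
  rename-cycleTree-twice τ = rename-cycleTree τ (twice τ) (λ _ → refl)

  swapped-half-≅ : ∀ {τ m a} {l r : Tree {N}} → rename τ l ≅ r → l ≅ cycleTree (twice τ) m a → r ≅ cycleTree (twice τ) m (τ a)
  swapped-half-≅ {τ} {m} {a} wl l≅ = ≅-trans (≅-sym wl) (subst (rename τ _ ≅_) (rename-cycleTree-twice τ m a) (rename-≅ τ l≅))

  mutual
    cycleTree-unique : ∀ {τ m a} → PowerCycle τ m a → ∀ s → Distinct s → rename τ s ≅ s →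
                       (∀ x → x ∈ᵗ s → InOrbit τ a x) → (∀ x → InOrbit τ a x → x ∈ᵗ s) →
                       s ≅ cycleTree τ m a
    cycleTree-unique {m = zero} G (leaf x) _ _ _ orbit⊆ with orbit⊆ _ (0 , refl)
    ... | at-leaf = leaf≅ x
    cycleTree-unique {τ} {suc m} G (leaf x) _ _ _ orbit⊆ with orbit⊆ _ (0 , refl)
    ... | at-leaf with () ← exact-period G 1 (s≤s z≤n) (*-monoʳ-≤ 2 (m^n>0 2 m)) (∈ᵗ-leaf⁻ (orbit⊆ _ (1 , refl)))
    cycleTree-unique G (node l r) (_ , _ , l#r) (straight wl wr) ⊆orbit orbit⊆ with orbit⊆ _ (0 , refl)
    ... | in-left a∈l with some-leaf r
    ...   | y , y∈r with () ← l#r _ a∈l (InOrbit-closed G wr y∈r (⊆orbit y (in-right y∈r)))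
    cycleTree-unique G (node l r) (_ , _ , l#r) (straight wl wr) ⊆orbit orbit⊆
      | in-right a∈r with some-leaf l
    ...   | y , y∈l with () ← l#r _ (InOrbit-closed G wl y∈l (⊆orbit y (in-left y∈l))) a∈r
    cycleTree-unique {τ} G (node l r) (dl , dr , l#r) (cross wl wr) ⊆orbit orbit⊆
      with swap⇒exponent-suc G l#r wl | orbit⊆ _ (0 , refl)
    ... | m′ , refl | in-left a∈l =
      let l≅ = cycleTree-unique-half G dl l#r wl wr a∈l (λ x x∈ → ⊆orbit x (in-left x∈))
      in straight l≅ (swapped-half-≅ wl l≅)
    ... | m′ , refl | in-right a∈r =
      let r≅ = cycleTree-unique-half G dr (λ x x∈r x∈l → l#r x x∈l x∈r) wr wl a∈r (λ x x∈ → ⊆orbit x (in-right x∈))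
      in cross (swapped-half-≅ wr r≅) r≅

    cycleTree-unique-half : ∀ {τ m a} {l r : Tree {N}} → PowerCycle τ (suc m) a → Distinct l → Disjointᵗ l r →
                            (wl : rename τ l ≅ r) (wr : rename τ r ≅ l) → a ∈ᵗ l →
                            (∀ x → x ∈ᵗ l → InOrbit τ a x) → l ≅ cycleTree (twice τ) m a
    cycleTree-unique-half {l = l} G dl l#r wl wr a∈l ⊆orbit =
      cycleTree-unique (PowerCycle-twice G) l dl (rename-twice-≅ wl wr)
        (λ x x∈ → InOrbit⇒InOrbit-twice wl wr a∈l l#r x∈ (⊆orbit x x∈))
        (λ x x∈orbit → InOrbit-twice⇒∈ᵗ wl wr a∈l x∈orbit)

-- Pruning the cycle of a

NotBoth : Maybe Path → Maybe Path → Set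
NotBoth (just _) (just _) = ⊥
NotBoth _        _        = ⊤

module _ {N : ℕ} where

  node? : Maybe (Tree {N}) → Maybe (Tree {N}) → Maybe (Tree {N})
  node? nothing  r        = r
  node? (just l) nothing  = just l
  node? (just l) (just r) = just (node l r)

  -- When a child is pruned away completely the node is suppressed: if that child contained a, the
  -- attachment edge is the edge above the node, otherwise it is found in the other child.
  locate-node : (l′ r′ : Maybe (Tree {N})) (a∈l a∈r : Bool) (pl pr : Maybe Path) → Maybe Path
  locate-node nothing  nothing  _   _   _        _  = nothing
  locate-node nothing  (just _) a∈l _   _        pr = if a∈l then just root else pr
  locate-node (just _) nothing  _   a∈r pl       _  = if a∈r then just root else pl
  locate-node (just _) (just _) _   _   (just p) _  = just (left p)
  locate-node (just _) (just _) _   _   nothing  pr = Maybe.map right pr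

  locate-node-cong : ∀ {l′ l″ r′ r″ : Maybe (Tree {N})} {a∈l a∈l′ a∈r a∈r′ pl pl′ pr pr′} →
                     l′ ≡ l″ → r′ ≡ r″ → a∈l ≡ a∈l′ → a∈r ≡ a∈r′ → pl ≡ pl′ → pr ≡ pr′ →
                     locate-node l′ r′ a∈l a∈r pl pr ≡ locate-node l″ r″ a∈l′ a∈r′ pl′ pr′
  locate-node-cong refl refl refl refl refl refl = refl

  locate-node-just : ∀ l′ r′ a∈l a∈r pl pr →
    (a∈l ≡ true × (∀ {l″} → l′ ≡ just l″ → ∃ λ p → pl ≡ just p)) ⊎
    (a∈r ≡ true × (∀ {r″} → r′ ≡ just r″ → ∃ λ p → pr ≡ just p)) →
    ∀ {t′} → node? l′ r′ ≡ just t′ → ∃ λ p → locate-node l′ r′ a∈l a∈r pl pr ≡ just p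
  locate-node-just nothing  nothing  _     _     _        _  _                  ()
  locate-node-just nothing  (just _) true  _     _        _  _                  _ = root , refl
  locate-node-just nothing  (just _) false _     _        _  (inj₁ (() , _))    _
  locate-node-just nothing  (just _) false _     _        _  (inj₂ (_ , in-r))  _ = in-r refl
  locate-node-just (just _) nothing  _     true  _        _  _                  _ = root , refl
  locate-node-just (just _) nothing  _     false _        _  (inj₁ (_ , in-l))  _ = in-l refl
  locate-node-just (just _) nothing  _     false _        _  (inj₂ (() , _))    _
  locate-node-just (just _) (just _) _     _     (just p) _  _                  _ = left p , refl
  locate-node-just (just _) (just _) _     _     nothing  _  (inj₁ (_ , in-l))  _ with () ← proj₂ (in-l refl)
  locate-node-just (just _) (just _) _     _     nothing  pr (inj₂ (_ , in-r))  _ with in-r refl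
  ... | p , refl = right p , refl

  _∈ᵐ_ : Fin N → Maybe (Tree {N}) → Set
  x ∈ᵐ nothing = ⊥
  x ∈ᵐ just t  = x ∈ᵗ t

  ∈ᵐ-node?⁺ˡ : ∀ {x} l′ r′ → x ∈ᵐ l′ → x ∈ᵐ node? l′ r′
  ∈ᵐ-node?⁺ˡ (just _) nothing  x∈ = x∈
  ∈ᵐ-node?⁺ˡ (just _) (just _) x∈ = in-left x∈

  ∈ᵐ-node?⁺ʳ : ∀ {x} l′ r′ → x ∈ᵐ r′ → x ∈ᵐ node? l′ r′
  ∈ᵐ-node?⁺ʳ nothing  (just _) x∈ = x∈
  ∈ᵐ-node?⁺ʳ (just _) (just _) x∈ = in-right x∈

  ∈ᵐ-node?⁻ : ∀ {x} l′ r′ → x ∈ᵐ node? l′ r′ → x ∈ᵐ l′ ⊎ x ∈ᵐ r′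
  ∈ᵐ-node?⁻ nothing  _        x∈            = inj₂ x∈
  ∈ᵐ-node?⁻ (just _) nothing  x∈            = inj₁ x∈
  ∈ᵐ-node?⁻ (just _) (just _) (in-left x∈)  = inj₁ x∈
  ∈ᵐ-node?⁻ (just _) (just _) (in-right x∈) = inj₂ x∈

  Distinctᵐ : Maybe (Tree {N}) → Set
  Distinctᵐ nothing  = ⊤
  Distinctᵐ (just t) = Distinct t

  _≅ᵐ_ : Maybe (Tree {N}) → Maybe (Tree {N}) → Set
  nothing ≅ᵐ nothing = ⊤
  just t  ≅ᵐ just u  = t ≅ u
  _       ≅ᵐ _       = ⊥

  transportPathᵐ : ∀ {t′ u′} → t′ ≅ᵐ u′ → Path → Path
  transportPathᵐ {just _}  {just _}  i = transportPath i
  transportPathᵐ {nothing} {nothing} _ = λ p → p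

  ≅ᵐ-just : ∀ {t′ u′ t u} → t′ ≡ just t → u′ ≡ just u → (i : t′ ≅ᵐ u′) →
            Σ (t ≅ u) λ j → ∀ p → transportPathᵐ i p ≡ transportPath j p
  ≅ᵐ-just refl refl i = i , λ _ → refl

  node?-≅ : ∀ {l′ l″ r′ r″} → l′ ≅ᵐ l″ → r′ ≅ᵐ r″ → node? l′ r′ ≅ᵐ node? l″ r″
  node?-≅ {nothing} {nothing} _ j                     = j
  node?-≅ {just _}  {just _}  {nothing} {nothing} i _ = i
  node?-≅ {just _}  {just _}  {just _}  {just _}  i j = straight i j

  node?-≅-swap : ∀ {l′ l″ r′ r″} → l′ ≅ᵐ r″ → r′ ≅ᵐ l″ → node? l′ r′ ≅ᵐ node? l″ r″
  node?-≅-swap {nothing} {nothing} {nothing} {nothing} _ _ = tt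
  node?-≅-swap {nothing} {just _}  {just _}  {nothing} _ j = j
  node?-≅-swap {just _}  {nothing} {nothing} {just _}  i _ = i
  node?-≅-swap {just _}  {just _}  {just _}  {just _}  i j = cross i j

  locate-node-straight : ∀ {l′ l″ r′ r″} (i : l′ ≅ᵐ l″) (j : r′ ≅ᵐ r″) a∈l a∈r pl pr →
    locate-node l″ r″ a∈l a∈r (Maybe.map (transportPathᵐ i) pl) (Maybe.map (transportPathᵐ j) pr) ≡
    Maybe.map (transportPathᵐ (node?-≅ i j)) (locate-node l′ r′ a∈l a∈r pl pr)
  locate-node-straight {nothing} {nothing} {nothing} {nothing} _ _ _     _     _        _        = refl
  locate-node-straight {nothing} {nothing} {just _}  {just _}  _ _ true  _     _        _        = refl
  locate-node-straight {nothing} {nothing} {just _}  {just _}  _ _ false _     _        _        = refl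
  locate-node-straight {just _}  {just _}  {nothing} {nothing} _ _ _     true  _        _        = refl
  locate-node-straight {just _}  {just _}  {nothing} {nothing} _ _ _     false _        _        = refl
  locate-node-straight {just _}  {just _}  {just _}  {just _}  _ _ _     _     (just _) _        = refl
  locate-node-straight {just _}  {just _}  {just _}  {just _}  _ _ _     _     nothing  nothing  = refl
  locate-node-straight {just _}  {just _}  {just _}  {just _}  _ _ _     _     nothing  (just _) = refl

  locate-node-cross : ∀ {l′ l″ r′ r″} (i : l′ ≅ᵐ r″) (j : r′ ≅ᵐ l″) a∈l a∈r pl pr → NotBoth pl pr →
    locate-node l″ r″ a∈r a∈l (Maybe.map (transportPathᵐ j) pr) (Maybe.map (transportPathᵐ i) pl) ≡
    Maybe.map (transportPathᵐ (node?-≅-swap i j)) (locate-node l′ r′ a∈l a∈r pl pr)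
  locate-node-cross {nothing} {nothing} {nothing} {nothing} _ _ _     _     _        _        _ = refl
  locate-node-cross {nothing} {just _}  {just _}  {nothing} _ _ true  _     _        _        _ = refl
  locate-node-cross {nothing} {just _}  {just _}  {nothing} _ _ false _     _        _        _ = refl
  locate-node-cross {just _}  {nothing} {nothing} {just _}  _ _ _     true  _        _        _ = refl
  locate-node-cross {just _}  {nothing} {nothing} {just _}  _ _ _     false _        _        _ = refl
  locate-node-cross {just _}  {just _}  {just _}  {just _}  _ _ _     _     (just _) nothing  _ = refl
  locate-node-cross {just _}  {just _}  {just _}  {just _}  _ _ _     _     nothing  nothing  _ = refl
  locate-node-cross {just _}  {just _}  {just _}  {just _}  _ _ _     _     nothing  (just _) _ = refl

-- prune deletes the leaves x with drop x ≡ true and suppresses the nodes left with one child;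
-- locate gives the path, in the pruned tree, of the edge where the deleted part containing a hung.
module Pruning {N : ℕ} (drop : Fin N → Bool) (a : Fin N) where

  prune : Tree {N} → Maybe (Tree {N})
  prune (leaf x)   = if drop x then nothing else just (leaf x)
  prune (node l r) = node? (prune l) (prune r)

  locate : Tree {N} → Maybe Path
  locate (leaf x)   = nothing
  locate (node l r) = locate-node (prune l) (prune r) (does (a ∈ᵗ? l)) (does (a ∈ᵗ? r)) (locate l) (locate r)

  ∈ᵐ-prune⁺ : ∀ {x} t → x ∈ᵗ t → drop x ≡ false → x ∈ᵐ prune t
  ∈ᵐ-prune⁺ (leaf x)   at-leaf       kept rewrite kept = at-leaf
  ∈ᵐ-prune⁺ (node l r) (in-left x∈)  kept = ∈ᵐ-node?⁺ˡ (prune l) (prune r) (∈ᵐ-prune⁺ l x∈ kept)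
  ∈ᵐ-prune⁺ (node l r) (in-right x∈) kept = ∈ᵐ-node?⁺ʳ (prune l) (prune r) (∈ᵐ-prune⁺ r x∈ kept)

  ∈ᵐ-prune⁻ : ∀ {x} t → x ∈ᵐ prune t → x ∈ᵗ t × drop x ≡ false
  ∈ᵐ-prune⁻ (leaf y) x∈ with drop y in kept
  ∈ᵐ-prune⁻ (leaf y) at-leaf | false = at-leaf , kept
  ∈ᵐ-prune⁻ (node l r) x∈ with ∈ᵐ-node?⁻ (prune l) (prune r) x∈
  ... | inj₁ x∈l = let x∈ , kept = ∈ᵐ-prune⁻ l x∈l in in-left x∈ , kept
  ... | inj₂ x∈r = let x∈ , kept = ∈ᵐ-prune⁻ r x∈r in in-right x∈ , kept

  Distinct-prune : ∀ t → Distinct t → Distinctᵐ (prune t)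
  Distinct-prune (leaf x)   _ with drop x
  ... | true  = tt
  ... | false = tt
  Distinct-prune (node l r) (dl , dr , l#r) =
    Distinctᵐ-node? (prune l) (prune r) (Distinct-prune l dl) (Distinct-prune r dr)
      (λ x x∈l x∈r → l#r x (proj₁ (∈ᵐ-prune⁻ l x∈l)) (proj₁ (∈ᵐ-prune⁻ r x∈r)))
    where
      Distinctᵐ-node? : ∀ l′ r′ → Distinctᵐ l′ → Distinctᵐ r′ → (∀ x → x ∈ᵐ l′ → ¬ x ∈ᵐ r′) →
                        Distinctᵐ (node? l′ r′)
      Distinctᵐ-node? nothing  _        _  dr _   = dr
      Distinctᵐ-node? (just _) nothing  dl _  _   = dl
      Distinctᵐ-node? (just _) (just _) dl dr l#r = dl , dr , l#r

  prune-keep-all : ∀ t → (∀ x → x ∈ᵗ t → drop x ≡ false) → prune t ≡ just t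
  prune-keep-all (leaf x)   kept rewrite kept x at-leaf = refl
  prune-keep-all (node l r) kept
    rewrite prune-keep-all l (λ x → kept x ∘ in-left) | prune-keep-all r (λ x → kept x ∘ in-right) = refl

  prune-drop-all : ∀ t → (∀ x → x ∈ᵗ t → drop x ≡ true) → prune t ≡ nothing
  prune-drop-all (leaf x)   dropped rewrite dropped x at-leaf = refl
  prune-drop-all (node l r) dropped
    rewrite prune-drop-all l (λ x → dropped x ∘ in-left) | prune-drop-all r (λ x → dropped x ∘ in-right) = refl

  prune-rename : ∀ f → (∀ x → drop (f x) ≡ drop x) → ∀ t → prune (rename f t) ≡ Maybe.map (rename f) (prune t)
  prune-rename f drop-f (leaf x) rewrite drop-f x with drop x
  ... | true  = refl
  ... | false = refl
  prune-rename f drop-f (node l r) rewrite prune-rename f drop-f l | prune-rename f drop-f r = node?-map (prune l) (prune r)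
    where
      node?-map : ∀ l′ r′ → node? (Maybe.map (rename f) l′) (Maybe.map (rename f) r′) ≡ Maybe.map (rename f) (node? l′ r′)
      node?-map nothing  _        = refl
      node?-map (just _) nothing  = refl
      node?-map (just _) (just _) = refl

  ∉⇒locate-nothing : ∀ t → ¬ a ∈ᵗ t → locate t ≡ nothing
  ∉⇒locate-nothing (leaf x)   _  = refl
  ∉⇒locate-nothing (node l r) a∉
    rewrite dec-false (a ∈ᵗ? l) (a∉ ∘ in-left) | dec-false (a ∈ᵗ? r) (a∉ ∘ in-right)
          | ∉⇒locate-nothing l (a∉ ∘ in-left) | ∉⇒locate-nothing r (a∉ ∘ in-right)
    = locate-node-nothing (prune l) (prune r)
    where
      locate-node-nothing : ∀ l′ r′ → locate-node l′ r′ false false nothing nothing ≡ nothing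
      locate-node-nothing nothing  nothing  = refl
      locate-node-nothing nothing  (just _) = refl
      locate-node-nothing (just _) nothing  = refl
      locate-node-nothing (just _) (just _) = refl

  locate⇒∈ᵗ : ∀ t {p} → locate t ≡ just p → a ∈ᵗ t
  locate⇒∈ᵗ t eq with a ∈ᵗ? t
  ... | yes a∈ = a∈
  ... | no a∉ with () ← trans (sym eq) (∉⇒locate-nothing t a∉)

  locate-PathIn : ∀ t {p t′} → locate t ≡ just p → prune t ≡ just t′ → PathIn t′ p
  locate-PathIn (leaf x)   ()
  locate-PathIn (node l r) =
    locate-node-PathIn (prune l) (prune r) (does (a ∈ᵗ? l)) (does (a ∈ᵗ? r)) (locate l) (locate r)
      (locate-PathIn l) (locate-PathIn r)
    where
      locate-node-PathIn : ∀ l′ r′ a∈l a∈r pl pr →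
        (∀ {p l″} → pl ≡ just p → l′ ≡ just l″ → PathIn l″ p) →
        (∀ {p r″} → pr ≡ just p → r′ ≡ just r″ → PathIn r″ p) →
        ∀ {p t′} → locate-node l′ r′ a∈l a∈r pl pr ≡ just p → node? l′ r′ ≡ just t′ → PathIn t′ p
      locate-node-PathIn nothing  nothing  _     _     _        _        _  _  ()
      locate-node-PathIn nothing  (just _) true  _     _        _        _  _  refl refl = tt
      locate-node-PathIn nothing  (just _) false _     _        _        _  hr eq   refl = hr eq refl
      locate-node-PathIn (just _) nothing  _     true  _        _        _  _  refl refl = tt
      locate-node-PathIn (just _) nothing  _     false _        _        hl _  eq   refl = hl eq refl
      locate-node-PathIn (just _) (just _) _     _     (just _) _        hl _  refl refl = hl refl refl
      locate-node-PathIn (just _) (just _) _     _     nothing  (just _) _  hr refl refl = hr refl refl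
      locate-node-PathIn (just _) (just _) _     _     nothing  nothing  _  _  ()

  locate-exists : drop a ≡ true → ∀ t → a ∈ᵗ t → ∀ {t′} → prune t ≡ just t′ → ∃ λ p → locate t ≡ just p
  locate-exists a-dropped (leaf .a) at-leaf pruned rewrite a-dropped with () ← pruned
  locate-exists a-dropped (node l r) (in-left a∈l) =
    locate-node-just (prune l) (prune r) (does (a ∈ᵗ? l)) (does (a ∈ᵗ? r)) (locate l) (locate r)
      (inj₁ (dec-true (a ∈ᵗ? l) a∈l , locate-exists a-dropped l a∈l))
  locate-exists a-dropped (node l r) (in-right a∈r) =
    locate-node-just (prune l) (prune r) (does (a ∈ᵗ? l)) (does (a ∈ᵗ? r)) (locate l) (locate r)
      (inj₂ (dec-true (a ∈ᵗ? r) a∈r , locate-exists a-dropped r a∈r))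

  prune-≅ : ∀ {t u} → t ≅ u → prune t ≅ᵐ prune u
  prune-≅ (leaf≅ x) with drop x
  ... | true  = tt
  ... | false = leaf≅ x
  prune-≅ (straight i j) = node?-≅ (prune-≅ i) (prune-≅ j)
  prune-≅ (cross i j)    = node?-≅-swap (prune-≅ i) (prune-≅ j)

  private
    locate-NotBoth : ∀ l r → Disjointᵗ l r → NotBoth (locate l) (locate r)
    locate-NotBoth l r l#r with locate l in eqˡ | locate r in eqʳ
    ... | just _  | just _  = l#r a (locate⇒∈ᵗ l eqˡ) (locate⇒∈ᵗ r eqʳ)
    ... | just _  | nothing = tt
    ... | nothing | just _  = tt
    ... | nothing | nothing = tt

  locate-≅ : ∀ {t u} → Distinct t → (i : t ≅ u) → locate u ≡ Maybe.map (transportPathᵐ (prune-≅ i)) (locate t)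
  locate-≅ _ (leaf≅ x) = refl
  locate-≅ {node l r} (dl , dr , _) (straight i j)
    rewrite locate-≅ dl i | locate-≅ dr j | sym (does-∈ᵗ?-≅ {x = a} i) | sym (does-∈ᵗ?-≅ {x = a} j) =
    locate-node-straight (prune-≅ i) (prune-≅ j) _ _ (locate l) (locate r)
  locate-≅ {node l r} (dl , dr , l#r) (cross i j)
    rewrite locate-≅ dr j | locate-≅ dl i | sym (does-∈ᵗ?-≅ {x = a} i) | sym (does-∈ᵗ?-≅ {x = a} j) =
    locate-node-cross (prune-≅ i) (prune-≅ j) _ _ (locate l) (locate r) (locate-NotBoth l r l#r)

  prune≡nothing⇒dropped : ∀ t → prune t ≡ nothing → ∀ {x} → x ∈ᵗ t → drop x ≡ true
  prune≡nothing⇒dropped t pruned {x} x∈ with drop x in dropped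
  ... | true  = refl
  ... | false with () ← subst (x ∈ᵐ_) pruned (∈ᵐ-prune⁺ t x∈ dropped)

  ∈ᵗ-pruned⁻ : ∀ t {t′} → prune t ≡ just t′ → ∀ {x} → x ∈ᵗ t′ → x ∈ᵗ t × drop x ≡ false
  ∈ᵗ-pruned⁻ t pruned x∈ = ∈ᵐ-prune⁻ t (subst (_ ∈ᵐ_) (sym pruned) x∈)

  prune≡nothing-≅ : ∀ {t u} → t ≅ u → prune t ≡ nothing → prune u ≡ nothing
  prune≡nothing-≅ {t} {u} i pruned = nothing-≅ᵐ (prune u) (subst (_≅ᵐ prune u) pruned (prune-≅ i))
    where
      nothing-≅ᵐ : ∀ u′ → nothing ≅ᵐ u′ → u′ ≡ nothing
      nothing-≅ᵐ nothing _ = refl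

module _ {N : ℕ} where
  open Pruning

  prune-ext : ∀ (drop drop′ : Fin N → Bool) a t → (∀ x → x ∈ᵗ t → drop x ≡ drop′ x) → prune drop a t ≡ prune drop′ a t
  prune-ext drop drop′ a (leaf x)   same rewrite same x at-leaf = refl
  prune-ext drop drop′ a (node l r) same =
    cong₂ node? (prune-ext drop drop′ a l (λ x → same x ∘ in-left)) (prune-ext drop drop′ a r (λ x → same x ∘ in-right))

  locate-ext : ∀ (drop drop′ : Fin N → Bool) a t → (∀ x → x ∈ᵗ t → drop x ≡ drop′ x) → locate drop a t ≡ locate drop′ a t
  locate-ext drop drop′ a (leaf x)   same = refl
  locate-ext drop drop′ a (node l r) same =
    locate-node-cong (prune-ext drop drop′ a l sameˡ) (prune-ext drop drop′ a r sameʳ) refl refl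
                     (locate-ext drop drop′ a l sameˡ) (locate-ext drop drop′ a r sameʳ)
    where
      sameˡ : ∀ x → x ∈ᵗ l → drop x ≡ drop′ x
      sameˡ x = same x ∘ in-left
      sameʳ : ∀ x → x ∈ᵗ r → drop x ≡ drop′ x
      sameʳ x = same x ∘ in-right

-- Grafting the cycle of a

module _ {N : ℕ} where

  -- Below a node whose subtrees τ swaps, the half of the cycle through a is grafted into one subtree
  -- (with τ ∘ τ and half the cycle length) and its τ-image into the other.
  graft : (τ : Fin N → Fin N) (m : ℕ) (a : Fin N) (t : Tree {N}) → rename τ t ≅ t → Path → Tree {N}
  graft τ m a t          _                root      = node (cycleTree τ m a) t
  graft τ m a (leaf x)   _                (left _)  = leaf x
  graft τ m a (leaf x)   _                (right _) = leaf x
  graft τ m a (node l r) (straight wl _)  (left p)  = node (graft τ m a l wl p) r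
  graft τ m a (node l r) (straight _ wr)  (right p) = node l (graft τ m a r wr p)
  graft τ m a (node l r) (cross wl wr)    (left p)  =
    let l⁺ = graft (twice τ) (pred m) a l (rename-twice-≅ wl wr) p in node l⁺ (rename τ l⁺)
  graft τ m a (node l r) (cross wl wr)    (right p) =
    let r⁺ = graft (twice τ) (pred m) a r (rename-twice-≅ wr wl) p in node (rename τ r⁺) r⁺

  AvoidsOrbit : (Fin N → Fin N) → Fin N → Tree {N} → Set
  AvoidsOrbit τ a t = ∀ x → x ∈ᵗ t → ¬ InOrbit τ a x

  graft-∈ᵗ⁺ : ∀ {τ m a} → PowerCycle τ m a → ∀ t (w : rename τ t ≅ t) p → PathIn t p → Distinct t →
              ∀ {x} → x ∈ᵗ t → x ∈ᵗ graft τ m a t w p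
  graft-∈ᵗ⁺ G t          _               root      _  _               x∈             = in-right x∈
  graft-∈ᵗ⁺ G (node l r) (straight wl _) (left p)  ok (dl , _ , _)    (in-left x∈)   = in-left (graft-∈ᵗ⁺ G l wl p ok dl x∈)
  graft-∈ᵗ⁺ G (node l r) (straight _ _)  (left p)  _  _               (in-right x∈)  = in-right x∈
  graft-∈ᵗ⁺ G (node l r) (straight _ _)  (right p) _  _               (in-left x∈)   = in-left x∈
  graft-∈ᵗ⁺ G (node l r) (straight _ wr) (right p) ok (_ , dr , _)    (in-right x∈)  = in-right (graft-∈ᵗ⁺ G r wr p ok dr x∈)
  graft-∈ᵗ⁺ {τ} G (node l r) (cross wl wr) (left p) ok (dl , _ , l#r) x∈ with swap⇒exponent-suc G l#r wl | x∈
  ... | _ , refl | in-left x∈l  = in-left (graft-∈ᵗ⁺ (PowerCycle-twice G) l (rename-twice-≅ wl wr) p ok dl x∈l)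
  ... | _ , refl | in-right x∈r with ∈ᵗ-step⁻ wl x∈r
  ...   | y , y∈l , refl = in-right (∈ᵗ-rename⁺ τ (graft-∈ᵗ⁺ (PowerCycle-twice G) l (rename-twice-≅ wl wr) p ok dl y∈l))
  graft-∈ᵗ⁺ {τ} G (node l r) (cross wl wr) (right p) ok (_ , dr , l#r) x∈ with swap⇒exponent-suc G l#r wl | x∈
  ... | _ , refl | in-right x∈r = in-right (graft-∈ᵗ⁺ (PowerCycle-twice G) r (rename-twice-≅ wr wl) p ok dr x∈r)
  ... | _ , refl | in-left x∈l with ∈ᵗ-step⁻ wr x∈l
  ...   | y , y∈r , refl = in-left (∈ᵗ-rename⁺ τ (graft-∈ᵗ⁺ (PowerCycle-twice G) r (rename-twice-≅ wr wl) p ok dr y∈r))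

  graft-∈ᵗ-orbit : ∀ {τ m a} → PowerCycle τ m a → ∀ t (w : rename τ t ≅ t) p → PathIn t p → Distinct t →
                   ∀ {x} → InOrbit τ a x → x ∈ᵗ graft τ m a t w p
  graft-∈ᵗ-orbit {τ} {m} {a} G t _ root _ _ x∈orbit with InOrbit⇒InOrbitBelow G x∈orbit
  ... | i , i< , refl = in-left (∈ᵗ-cycleTree⁺ τ m a i<)
  graft-∈ᵗ-orbit G (node l r) (straight wl _) (left p)  ok (dl , _ , _) x∈orbit = in-left (graft-∈ᵗ-orbit G l wl p ok dl x∈orbit)
  graft-∈ᵗ-orbit G (node l r) (straight _ wr) (right p) ok (_ , dr , _) x∈orbit = in-right (graft-∈ᵗ-orbit G r wr p ok dr x∈orbit)
  graft-∈ᵗ-orbit {τ} {a = a} G (node l r) (cross wl wr) (left p) ok (dl , _ , l#r) (k , refl)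
    with swap⇒exponent-suc G l#r wl | parity k
  ... | _ , refl | j , inj₁ refl = in-left (graft-∈ᵗ-orbit (PowerCycle-twice G) l (rename-twice-≅ wl wr) p ok dl (j , iterate-twice τ j a))
  ... | _ , refl | j , inj₂ refl =
    in-right (∈ᵗ-rename⁺ τ (graft-∈ᵗ-orbit (PowerCycle-twice G) l (rename-twice-≅ wl wr) p ok dl (j , iterate-twice τ j a)))
  graft-∈ᵗ-orbit {τ} {a = a} G (node l r) (cross wl wr) (right p) ok (_ , dr , l#r) (k , refl)
    with swap⇒exponent-suc G l#r wl | parity k
  ... | _ , refl | j , inj₁ refl = in-right (graft-∈ᵗ-orbit (PowerCycle-twice G) r (rename-twice-≅ wr wl) p ok dr (j , iterate-twice τ j a))
  ... | _ , refl | j , inj₂ refl =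
    in-left (∈ᵗ-rename⁺ τ (graft-∈ᵗ-orbit (PowerCycle-twice G) r (rename-twice-≅ wr wl) p ok dr (j , iterate-twice τ j a)))

  graft-∈ᵗ⁻ : ∀ {τ m a} → PowerCycle τ m a → ∀ t (w : rename τ t ≅ t) p → PathIn t p → Distinct t →
              ∀ {x} → x ∈ᵗ graft τ m a t w p → x ∈ᵗ t ⊎ InOrbit τ a x
  graft-∈ᵗ⁻ {τ} {m} {a} G t _ root _ _ (in-left x∈) = let i , _ , eq = ∈ᵗ-cycleTree⁻ τ m a x∈ in inj₂ (i , eq)
  graft-∈ᵗ⁻ G t _ root _ _ (in-right x∈) = inj₁ x∈
  graft-∈ᵗ⁻ G (node l r) (straight wl _) (left p) ok (dl , _ , _) (in-left x∈) with graft-∈ᵗ⁻ G l wl p ok dl x∈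
  ... | inj₁ x∈l      = inj₁ (in-left x∈l)
  ... | inj₂ x∈orbit  = inj₂ x∈orbit
  graft-∈ᵗ⁻ G (node l r) (straight _ _) (left p)  _ _ (in-right x∈) = inj₁ (in-right x∈)
  graft-∈ᵗ⁻ G (node l r) (straight _ _) (right p) _ _ (in-left x∈)  = inj₁ (in-left x∈)
  graft-∈ᵗ⁻ G (node l r) (straight _ wr) (right p) ok (_ , dr , _) (in-right x∈) with graft-∈ᵗ⁻ G r wr p ok dr x∈
  ... | inj₁ x∈r      = inj₁ (in-right x∈r)
  ... | inj₂ x∈orbit  = inj₂ x∈orbit
  graft-∈ᵗ⁻ {τ} {a = a} G (node l r) (cross wl wr) (left p) ok (dl , _ , l#r) x∈ with swap⇒exponent-suc G l#r wl
  ... | m′ , refl = case x∈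
    where
      G² : PowerCycle (twice τ) m′ a
      G² = PowerCycle-twice G
      l⁺ : Tree {N}
      l⁺ = graft (twice τ) m′ a l (rename-twice-≅ wl wr) p
      case : ∀ {x} → x ∈ᵗ node l⁺ (rename τ l⁺) → x ∈ᵗ node l r ⊎ InOrbit τ a x
      case (in-left x∈) with graft-∈ᵗ⁻ G² l (rename-twice-≅ wl wr) p ok dl x∈
      ... | inj₁ x∈l     = inj₁ (in-left x∈l)
      ... | inj₂ x∈orbit = inj₂ (InOrbit-twice⇒InOrbit x∈orbit)
      case (in-right x∈) with ∈ᵗ-rename⁻ τ l⁺ x∈
      ... | y , y∈ , refl with graft-∈ᵗ⁻ G² l (rename-twice-≅ wl wr) p ok dl y∈
      ...   | inj₁ y∈l     = inj₁ (in-right (∈ᵗ-step wl y∈l))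
      ...   | inj₂ y∈orbit = inj₂ (InOrbit-step (InOrbit-twice⇒InOrbit y∈orbit))
  graft-∈ᵗ⁻ {τ} {a = a} G (node l r) (cross wl wr) (right p) ok (_ , dr , l#r) x∈ with swap⇒exponent-suc G l#r wl
  ... | m′ , refl = case x∈
    where
      G² : PowerCycle (twice τ) m′ a
      G² = PowerCycle-twice G
      r⁺ : Tree {N}
      r⁺ = graft (twice τ) m′ a r (rename-twice-≅ wr wl) p
      case : ∀ {x} → x ∈ᵗ node (rename τ r⁺) r⁺ → x ∈ᵗ node l r ⊎ InOrbit τ a x
      case (in-right x∈) with graft-∈ᵗ⁻ G² r (rename-twice-≅ wr wl) p ok dr x∈
      ... | inj₁ x∈r     = inj₁ (in-right x∈r)
      ... | inj₂ x∈orbit = inj₂ (InOrbit-twice⇒InOrbit x∈orbit)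
      case (in-left x∈) with ∈ᵗ-rename⁻ τ r⁺ x∈
      ... | y , y∈ , refl with graft-∈ᵗ⁻ G² r (rename-twice-≅ wr wl) p ok dr y∈
      ...   | inj₁ y∈r     = inj₁ (in-left (∈ᵗ-step wr y∈r))
      ...   | inj₂ y∈orbit = inj₂ (InOrbit-step (InOrbit-twice⇒InOrbit y∈orbit))

  Disjoint-rename : ∀ {τ m a} → PowerCycle τ (suc m) a → ∀ {l r s : Tree {N}} → rename τ l ≅ r → Disjointᵗ l r →
                    AvoidsOrbit τ a l → AvoidsOrbit τ a r → (∀ {x} → x ∈ᵗ s → x ∈ᵗ l ⊎ InOrbit (twice τ) a x) →
                    Disjointᵗ s (rename τ s)
  Disjoint-rename {τ} {a = a} G {s = s} wl l#r avoidˡ avoidʳ s⊆ z z∈s z∈τs with ∈ᵗ-rename⁻ τ s z∈τs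
  ... | y , y∈s , refl with s⊆ z∈s | s⊆ y∈s
  ...   | inj₁ τy∈l           | inj₁ y∈l           = l#r (τ y) τy∈l (∈ᵗ-step wl y∈l)
  ...   | inj₁ τy∈l           | inj₂ y∈orbit       = avoidˡ (τ y) τy∈l (InOrbit-step (InOrbit-twice⇒InOrbit y∈orbit))
  ...   | inj₂ τy∈orbit       | inj₁ y∈l           = avoidʳ (τ y) (∈ᵗ-step wl y∈l) (InOrbit-twice⇒InOrbit τy∈orbit)
  ...   | inj₂ (i , τy≡)      | inj₂ (j , refl)    =
    even≢odd-iterate G i j (trans (sym (iterate-twice τ i a)) (trans τy≡ (cong τ (iterate-twice τ j a))))

  Distinct-graft : ∀ {τ m a} → PowerCycle τ m a → ∀ t (w : rename τ t ≅ t) p → PathIn t p → Distinct t →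
                   AvoidsOrbit τ a t → Distinct (graft τ m a t w p)
  Distinct-graft {τ} {m} {a} G t _ root _ dt avoid =
    Distinct-cycleTree τ m a (iterate-injective-below G) , dt ,
    λ x x∈cycle x∈t → let i , _ , eq = ∈ᵗ-cycleTree⁻ τ m a x∈cycle in avoid x x∈t (i , eq)
  Distinct-graft G (node l r) (straight wl _) (left p) ok (dl , dr , l#r) avoid =
    Distinct-graft G l wl p ok dl (λ x → avoid x ∘ in-left) , dr , disjoint
    where
      disjoint : Disjointᵗ (graft _ _ _ l wl p) r
      disjoint x x∈ x∈r with graft-∈ᵗ⁻ G l wl p ok dl x∈
      ... | inj₁ x∈l     = l#r x x∈l x∈r
      ... | inj₂ x∈orbit = avoid x (in-right x∈r) x∈orbit
  Distinct-graft G (node l r) (straight _ wr) (right p) ok (dl , dr , l#r) avoid =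
    dl , Distinct-graft G r wr p ok dr (λ x → avoid x ∘ in-right) , disjoint
    where
      disjoint : Disjointᵗ l (graft _ _ _ r wr p)
      disjoint x x∈l x∈ with graft-∈ᵗ⁻ G r wr p ok dr x∈
      ... | inj₁ x∈r     = l#r x x∈l x∈r
      ... | inj₂ x∈orbit = avoid x (in-left x∈l) x∈orbit
  Distinct-graft {τ} {a = a} G (node l r) (cross wl wr) (left p) ok (dl , dr , l#r) avoid with swap⇒exponent-suc G l#r wl
  ... | m′ , refl = dl⁺ , Distinct-rename τ (injective G) l⁺ dl⁺ ,
                   Disjoint-rename G wl l#r (λ x → avoid x ∘ in-left) (λ x → avoid x ∘ in-right)
                     (graft-∈ᵗ⁻ (PowerCycle-twice G) l (rename-twice-≅ wl wr) p ok dl)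
    where
      l⁺ : Tree {N}
      l⁺ = graft (twice τ) m′ a l (rename-twice-≅ wl wr) p
      dl⁺ : Distinct l⁺
      dl⁺ = Distinct-graft (PowerCycle-twice G) l (rename-twice-≅ wl wr) p ok dl
              (λ x x∈ x∈orbit → avoid x (in-left x∈) (InOrbit-twice⇒InOrbit x∈orbit))
  Distinct-graft {τ} {a = a} G (node l r) (cross wl wr) (right p) ok (dl , dr , l#r) avoid with swap⇒exponent-suc G l#r wl
  ... | m′ , refl = Distinct-rename τ (injective G) r⁺ dr⁺ , dr⁺ ,
                   λ x x∈τr⁺ x∈r⁺ → Disjoint-rename G wr (λ y y∈r y∈l → l#r y y∈l y∈r)
                                      (λ x → avoid x ∘ in-right) (λ x → avoid x ∘ in-left)
                                      (graft-∈ᵗ⁻ (PowerCycle-twice G) r (rename-twice-≅ wr wl) p ok dr) x x∈r⁺ x∈τr⁺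
    where
      r⁺ : Tree {N}
      r⁺ = graft (twice τ) m′ a r (rename-twice-≅ wr wl) p
      dr⁺ : Distinct r⁺
      dr⁺ = Distinct-graft (PowerCycle-twice G) r (rename-twice-≅ wr wl) p ok dr
              (λ x x∈ x∈orbit → avoid x (in-right x∈) (InOrbit-twice⇒InOrbit x∈orbit))

  graft-invariant : ∀ {τ m a} → PowerCycle τ m a → ∀ t (w : rename τ t ≅ t) p → PathIn t p → Distinct t →
                    rename τ (graft τ m a t w p) ≅ graft τ m a t w p
  graft-invariant {τ} {m} {a} G t w root _ _ = straight (cycleTree-invariant τ m a (periodic G a)) w
  graft-invariant G (node l r) (straight wl wr) (left p)  ok (dl , _ , _) = straight (graft-invariant G l wl p ok dl) wr
  graft-invariant G (node l r) (straight wl wr) (right p) ok (_ , dr , _) = straight wl (graft-invariant G r wr p ok dr)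
  graft-invariant {τ} {a = a} G (node l r) (cross wl wr) (left p) ok (dl , _ , l#r) with swap⇒exponent-suc G l#r wl
  ... | m′ , refl = cross (≅-refl (rename τ l⁺)) (rename²-≅ l⁺ (graft-invariant (PowerCycle-twice G) l (rename-twice-≅ wl wr) p ok dl))
    where
      l⁺ : Tree {N}
      l⁺ = graft (twice τ) m′ a l (rename-twice-≅ wl wr) p
  graft-invariant {τ} {a = a} G (node l r) (cross wl wr) (right p) ok (_ , dr , l#r) with swap⇒exponent-suc G l#r wl
  ... | m′ , refl = cross (rename²-≅ r⁺ (graft-invariant (PowerCycle-twice G) r (rename-twice-≅ wr wl) p ok dr)) (≅-refl (rename τ r⁺))
    where
      r⁺ : Tree {N}
      r⁺ = graft (twice τ) m′ a r (rename-twice-≅ wr wl) p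

  graft-cong : ∀ {τ m a} {t u : Tree {N}} (i : t ≅ u) (w : rename τ t ≅ t) (w′ : rename τ u ≅ u) p → PathIn t p → Distinct t →
               graft τ m a t w p ≅ graft τ m a u w′ (transportPath i p)
  graft-cong {τ} {m} {a} i _ _ root _ _ = straight (≅-refl (cycleTree τ m a)) i
  graft-cong (straight i j) (straight wl _) (straight wl′ _) (left p)  ok (dl , _ , _) = straight (graft-cong i wl wl′ p ok dl) j
  graft-cong (straight i j) (straight _ wr) (straight _ wr′) (right p) ok (_ , dr , _) = straight i (graft-cong j wr wr′ p ok dr)
  graft-cong (straight i j) (cross wl wr) (cross wl′ wr′) (left p) ok (dl , _ , _) =
    let l⁺≅ = graft-cong i (rename-twice-≅ wl wr) (rename-twice-≅ wl′ wr′) p ok dl in straight l⁺≅ (rename-≅ _ l⁺≅)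
  graft-cong (straight i j) (cross wl wr) (cross wl′ wr′) (right p) ok (_ , dr , _) =
    let r⁺≅ = graft-cong j (rename-twice-≅ wr wl) (rename-twice-≅ wr′ wl′) p ok dr in straight (rename-≅ _ r⁺≅) r⁺≅
  graft-cong (cross i j) (straight wl _) (straight _ wr′) (left p)  ok (dl , _ , _) = cross (graft-cong i wl wr′ p ok dl) j
  graft-cong (cross i j) (straight _ wr) (straight wl′ _) (right p) ok (_ , dr , _) = cross i (graft-cong j wr wl′ p ok dr)
  graft-cong (cross i j) (cross wl wr) (cross wl′ wr′) (left p) ok (dl , _ , _) =
    let l⁺≅ = graft-cong i (rename-twice-≅ wl wr) (rename-twice-≅ wr′ wl′) p ok dl in cross l⁺≅ (rename-≅ _ l⁺≅)
  graft-cong (cross i j) (cross wl wr) (cross wl′ wr′) (right p) ok (_ , dr , _) =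
    let r⁺≅ = graft-cong j (rename-twice-≅ wr wl) (rename-twice-≅ wl′ wr′) p ok dr in cross (rename-≅ _ r⁺≅) r⁺≅
  graft-cong {τ} (straight i j) (straight wl _) (cross wl′ _) _ _ d =
    ⊥-elim (Distinct⇒children-≇ d (≅-trans (≅-sym wl) (≅-trans (rename-≅ τ i) (≅-trans wl′ (≅-sym j)))))
  graft-cong {τ} (straight i j) (cross wl _) (straight wl′ _) _ _ d =
    ⊥-elim (Distinct⇒children-≇ d (≅-trans i (≅-trans (≅-sym wl′) (≅-trans (rename-≅ τ (≅-sym i)) wl))))
  graft-cong {τ} (cross i j) (straight wl _) (cross _ wr′) _ _ d =
    ⊥-elim (Distinct⇒children-≇ d (≅-trans (≅-sym wl) (≅-trans (rename-≅ τ i) (≅-trans wr′ (≅-sym j)))))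
  graft-cong {τ} (cross i j) (cross wl _) (straight _ wr′) _ _ d =
    ⊥-elim (Distinct⇒children-≇ d (≅-trans (≅-sym (≅-trans (rename-≅ τ i) (≅-trans wr′ (≅-sym i)))) wl))

-- Pruning and grafting are mutually inverse

module _ {N : ℕ} where
  open Pruning

  record PrunesTo (drop : Fin N → Bool) (a : Fin N) (s t : Tree {N}) (p : Path) : Set where
    field
      pruned  : Tree {N}
      prune≡  : prune drop a s ≡ just pruned
      pruned≅ : pruned ≅ t
      path    : Path
      locate≡ : locate drop a s ≡ just path
      path≡   : transportPath pruned≅ path ≡ p

  -- Pruning the two halves `node X (rename τ X)` that `graft` creates below a swapping node.
  module SwappedHalf {τ m a} (G : PowerCycle τ (suc m) a) {l r : Tree {N}} (wl : rename τ l ≅ r) (wr : rename τ r ≅ l)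
                     p (ok : PathIn l p) (dl : Distinct l) (avoidˡ : AvoidsOrbit τ a l) (avoidʳ : AvoidsOrbit τ a r)
                     (ih : PrunesTo (inOrbitᵇ (twice τ) m a) a (graft (twice τ) m a l (rename-twice-≅ wl wr) p) l p) where

    open PrunesTo ih

    X : Tree {N}
    X = graft (twice τ) m a l (rename-twice-≅ wl wr) p

    X⊆ : ∀ {x} → x ∈ᵗ X → x ∈ᵗ l ⊎ InOrbit (twice τ) a x
    X⊆ = graft-∈ᵗ⁻ (PowerCycle-twice G) l (rename-twice-≅ wl wr) p ok dl

    drop-agrees : ∀ x → x ∈ᵗ X → inOrbitᵇ τ (suc m) a x ≡ inOrbitᵇ (twice τ) m a x
    drop-agrees x x∈ = inOrbitᵇ-cong G (PowerCycle-twice G) in-half InOrbit-twice⇒InOrbit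
      where
        in-half : InOrbit τ a x → InOrbit (twice τ) a x
        in-half x∈orbit with X⊆ x∈
        ... | inj₁ x∈l      = ⊥-elim (avoidˡ x x∈l x∈orbit)
        ... | inj₂ x∈orbit² = x∈orbit²

    a∉τX : ¬ a ∈ᵗ rename τ X
    a∉τX a∈ with ∈ᵗ-rename⁻ τ X a∈
    ... | y , y∈ , τy≡a with X⊆ y∈
    ...   | inj₁ y∈l       = avoidʳ a (subst (_∈ᵗ r) τy≡a (∈ᵗ-step wl y∈l)) (0 , refl)
    ...   | inj₂ (j , refl) = even≢odd-iterate G 0 j (sym (trans (cong τ (sym (iterate-twice τ j a))) τy≡a))

    prune-X : prune (inOrbitᵇ τ (suc m) a) a X ≡ just pruned
    prune-X = trans (prune-ext _ _ a X drop-agrees) prune≡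

    locate-X : locate (inOrbitᵇ τ (suc m) a) a X ≡ just path
    locate-X = trans (locate-ext _ _ a X drop-agrees) locate≡

    prune-τX : prune (inOrbitᵇ τ (suc m) a) a (rename τ X) ≡ just (rename τ pruned)
    prune-τX = trans (prune-rename _ a τ (inOrbitᵇ-step G) X) (cong (Maybe.map (rename τ)) prune-X)

    locate-τX : locate (inOrbitᵇ τ (suc m) a) a (rename τ X) ≡ nothing
    locate-τX = ∉⇒locate-nothing _ a (rename τ X) a∉τX

  prune-graft : ∀ {τ m a} → PowerCycle τ m a → ∀ t (w : rename τ t ≅ t) p → PathIn t p → Distinct t →
                AvoidsOrbit τ a t → PrunesTo (inOrbitᵇ τ m a) a (graft τ m a t w p) t p
  prune-graft {τ} {m} {a} G t w root _ _ avoid = record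
    { pruned = t ; prune≡ = cong₂ node? cycle-pruned t-kept ; pruned≅ = ≅-refl t ; path = root
    ; locate≡ = locate-node-cong cycle-pruned t-kept (dec-true (a ∈ᵗ? cycleTree τ m a) (∈ᵗ-cycleTree⁺ τ m a (m^n>0 2 m)))
                                 refl refl refl
    ; path≡ = refl }
    where
      cycle-pruned : prune (inOrbitᵇ τ m a) a (cycleTree τ m a) ≡ nothing
      cycle-pruned = prune-drop-all _ a _ λ x x∈ → inOrbitᵇ-complete G (InOrbitBelow⇒InOrbit (∈ᵗ-cycleTree⁻ τ m a x∈))
      t-kept : prune (inOrbitᵇ τ m a) a t ≡ just t
      t-kept = prune-keep-all _ a t λ x x∈ → inOrbitᵇ-false {m = m} (avoid x x∈)
  prune-graft {τ} {m} {a} G (node l r) (straight wl wr) (left p) ok (dl , dr , _) avoid = record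
    { pruned = node pruned r ; prune≡ = cong₂ node? prune≡ r-kept ; pruned≅ = straight pruned≅ (≅-refl r)
    ; path = left path ; locate≡ = locate-node-cong prune≡ r-kept refl refl locate≡ refl ; path≡ = cong left path≡ }
    where
      open PrunesTo (prune-graft G l wl p ok dl (λ x → avoid x ∘ in-left))
      r-kept : prune (inOrbitᵇ τ m a) a r ≡ just r
      r-kept = prune-keep-all _ a r λ x x∈ → inOrbitᵇ-false {m = m} (avoid x (in-right x∈))
  prune-graft {τ} {m} {a} G (node l r) (straight wl wr) (right p) ok (dl , dr , _) avoid = record
    { pruned = node l pruned ; prune≡ = cong₂ node? l-kept prune≡ ; pruned≅ = straight (≅-refl l) pruned≅
    ; path = right path ; locate≡ = locate-node-cong l-kept prune≡ refl refl l-unlocated locate≡ ; path≡ = cong right path≡ }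
    where
      open PrunesTo (prune-graft G r wr p ok dr (λ x → avoid x ∘ in-right))
      l-kept : prune (inOrbitᵇ τ m a) a l ≡ just l
      l-kept = prune-keep-all _ a l λ x x∈ → inOrbitᵇ-false {m = m} (avoid x (in-left x∈))
      l-unlocated : locate (inOrbitᵇ τ m a) a l ≡ nothing
      l-unlocated = ∉⇒locate-nothing _ a l λ a∈l → avoid a (in-left a∈l) (0 , refl)
  prune-graft {τ} {a = a} G (node l r) (cross wl wr) (left p) ok (dl , _ , l#r) avoid with swap⇒exponent-suc G l#r wl
  ... | m′ , refl = record
    { pruned = node pruned (rename τ pruned) ; prune≡ = cong₂ node? prune-X prune-τX
    ; pruned≅ = straight pruned≅ (≅-trans (rename-≅ τ pruned≅) wl)
    ; path = left path ; locate≡ = locate-node-cong prune-X prune-τX refl refl locate-X locate-τX ; path≡ = cong left path≡ }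
    where
      ih : PrunesTo (inOrbitᵇ (twice τ) m′ a) a (graft (twice τ) m′ a l (rename-twice-≅ wl wr) p) l p
      ih = prune-graft (PowerCycle-twice G) l (rename-twice-≅ wl wr) p ok dl
             (λ x x∈ → avoid x (in-left x∈) ∘ InOrbit-twice⇒InOrbit)
      open PrunesTo ih
      open SwappedHalf G wl wr p ok dl (λ x → avoid x ∘ in-left) (λ x → avoid x ∘ in-right) ih
  prune-graft {τ} {a = a} G (node l r) (cross wl wr) (right p) ok (_ , dr , l#r) avoid with swap⇒exponent-suc G l#r wl
  ... | m′ , refl = record
    { pruned = node (rename τ pruned) pruned ; prune≡ = cong₂ node? prune-τX prune-X
    ; pruned≅ = straight (≅-trans (rename-≅ τ pruned≅) wr) pruned≅
    ; path = right path ; locate≡ = locate-node-cong prune-τX prune-X refl refl locate-τX locate-X ; path≡ = cong right path≡ }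
    where
      ih : PrunesTo (inOrbitᵇ (twice τ) m′ a) a (graft (twice τ) m′ a r (rename-twice-≅ wr wl) p) r p
      ih = prune-graft (PowerCycle-twice G) r (rename-twice-≅ wr wl) p ok dr
             (λ x x∈ → avoid x (in-right x∈) ∘ InOrbit-twice⇒InOrbit)
      open PrunesTo ih
      open SwappedHalf G wr wl p ok dr (λ x → avoid x ∘ in-right) (λ x → avoid x ∘ in-left) ih

module _ {N : ℕ} where
  open Pruning

  avoids-orbit : ∀ {τ m a} → PowerCycle τ m a → ∀ {s : Tree {N}} → rename τ s ≅ s → ¬ a ∈ᵗ s → AvoidsOrbit τ a s
  avoids-orbit G w a∉ x x∈ x∈orbit = a∉ (InOrbit-closed G w x∈ x∈orbit)

  closed-subtree-kept : ∀ {τ m a} → PowerCycle τ m a → ∀ {s : Tree {N}} → rename τ s ≅ s → ¬ a ∈ᵗ s →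
                        prune (inOrbitᵇ τ m a) a s ≡ just s
  closed-subtree-kept {m = m} {a} G w a∉ =
    prune-keep-all _ a _ λ x x∈ → inOrbitᵇ-false {m = m} (avoids-orbit G w a∉ x x∈)

  pruned-away-swap : ∀ {τ m a} → PowerCycle τ m a → ∀ {l r : Tree {N}} → rename τ l ≅ r →
                     prune (inOrbitᵇ τ m a) a l ≡ nothing → prune (inOrbitᵇ τ m a) a r ≡ nothing
  pruned-away-swap {τ} {m} {a} G {l} wl pruned =
    prune≡nothing-≅ (inOrbitᵇ τ m a) a wl
      (trans (prune-rename (inOrbitᵇ τ m a) a τ (inOrbitᵇ-step G) l) (cong (Maybe.map (rename τ)) pruned))

  mutual
    graft-prune : ∀ {τ m a} → PowerCycle τ m a → ∀ t → Distinct t → (w : rename τ t ≅ t) → a ∈ᵗ t →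
                  ∀ {t′ p} → prune (inOrbitᵇ τ m a) a t ≡ just t′ → locate (inOrbitᵇ τ m a) a t ≡ just p →
                  (w′ : rename τ t′ ≅ t′) → graft τ m a t′ w′ p ≅ t
    graft-prune G (leaf _) _ _ _ _ () _
    graft-prune {a = a} G (node l r) (dl , dr , l#r) (straight wl wr) (in-left a∈l) =
      graft-prune-straightˡ G dl l#r wl a∈l (closed-subtree-kept G wr (l#r a a∈l))
    graft-prune {a = a} G (node l r) (dl , dr , l#r) (straight wl wr) (in-right a∈r) =
      graft-prune-straightʳ G dr l#r wr a∈r (closed-subtree-kept G wl (λ a∈l → l#r a a∈l a∈r))
        (∉⇒locate-nothing _ a l λ a∈l → l#r a a∈l a∈r)
    graft-prune G (node l r) (dl , dr , l#r) (cross wl wr) a∈ with swap⇒exponent-suc G l#r wl | a∈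
    ... | _ , refl | in-left a∈l  = graft-prune-crossˡ G dl l#r wl wr a∈l
    ... | _ , refl | in-right a∈r = graft-prune-crossʳ G dr l#r wl wr a∈r

    graft-prune-straightˡ : ∀ {τ m a} → PowerCycle τ m a → ∀ {l r} → Distinct l → Disjointᵗ l r → (wl : rename τ l ≅ l) →
      a ∈ᵗ l → prune (inOrbitᵇ τ m a) a r ≡ just r →
      ∀ {t′ p} → prune (inOrbitᵇ τ m a) a (node l r) ≡ just t′ → locate (inOrbitᵇ τ m a) a (node l r) ≡ just p →
      (w′ : rename τ t′ ≅ t′) → graft τ m a t′ w′ p ≅ node l r
    graft-prune-straightˡ {τ} {m} {a} G {l} {r} dl l#r wl a∈l r-kept pruned located w′
      with prune (inOrbitᵇ τ m a) a l in prune-l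
    ... | nothing with just-injective (trans (sym pruned) r-kept)
                     | just-injective {y = root} (trans (sym located) (locate-node-cong {a∈r′ = does (a ∈ᵗ? r)}
                         {pl′ = locate (inOrbitᵇ τ m a) a l} {pr′ = locate (inOrbitᵇ τ m a) a r}
                         (refl {x = nothing}) r-kept (dec-true (a ∈ᵗ? l) a∈l) refl refl refl))
    ...   | refl | refl = straight (≅-sym l≅cycle) (≅-refl r)
      where
        l≅cycle : l ≅ cycleTree τ m a
        l≅cycle = cycleTree-unique G l dl wl (λ x x∈ → inOrbitᵇ-sound {m = m} (prune≡nothing⇒dropped (inOrbitᵇ τ m a) a l prune-l x∈))
                                             (λ x x∈orbit → InOrbit⇒∈ᵗ wl a∈l x∈orbit)
    graft-prune-straightˡ {τ} {m} {a} G {l} {r} dl l#r wl a∈l r-kept pruned located w′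
      | just l′ with locate-exists _ a (inOrbitᵇ-self G) l a∈l prune-l
    ... | q , locate-l with just-injective (trans (sym pruned) (cong (node? (just l′)) r-kept))
                          | just-injective {y = left q} (trans (sym located) (locate-node-cong (refl {x = just l′}) r-kept refl refl locate-l refl))
    ...   | refl | refl with w′
    ...     | straight wl′ _ = straight (graft-prune G l dl wl a∈l prune-l locate-l wl′) (≅-refl r)
    ...     | cross wl′ _ with some-leaf l′
    ...       | y , y∈l′ = ⊥-elim (l#r (τ y) (∈ᵗ-step wl (proj₁ (∈ᵗ-pruned⁻ (inOrbitᵇ τ m a) a l prune-l y∈l′))) (∈ᵗ-step wl′ y∈l′))

    graft-prune-straightʳ : ∀ {τ m a} → PowerCycle τ m a → ∀ {l r} → Distinct r → Disjointᵗ l r → (wr : rename τ r ≅ r) →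
      a ∈ᵗ r → prune (inOrbitᵇ τ m a) a l ≡ just l → locate (inOrbitᵇ τ m a) a l ≡ nothing →
      ∀ {t′ p} → prune (inOrbitᵇ τ m a) a (node l r) ≡ just t′ → locate (inOrbitᵇ τ m a) a (node l r) ≡ just p →
      (w′ : rename τ t′ ≅ t′) → graft τ m a t′ w′ p ≅ node l r
    graft-prune-straightʳ {τ} {m} {a} G {l} {r} dr l#r wr a∈r l-kept l-unlocated pruned located w′
      with prune (inOrbitᵇ τ m a) a r in prune-r
    ... | nothing with just-injective (trans (sym pruned) (cong (λ l′ → node? l′ nothing) l-kept))
                     | just-injective {y = root} (trans (sym located) (locate-node-cong l-kept refl refl (dec-true (a ∈ᵗ? r) a∈r) refl refl))
    ...   | refl | refl = cross (≅-sym r≅cycle) (≅-refl l)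
      where
        r≅cycle : r ≅ cycleTree τ m a
        r≅cycle = cycleTree-unique G r dr wr (λ x x∈ → inOrbitᵇ-sound {m = m} (prune≡nothing⇒dropped (inOrbitᵇ τ m a) a r prune-r x∈))
                                             (λ x x∈orbit → InOrbit⇒∈ᵗ wr a∈r x∈orbit)
    graft-prune-straightʳ {τ} {m} {a} G {l} {r} dr l#r wr a∈r l-kept l-unlocated pruned located w′
      | just r′ with locate-exists _ a (inOrbitᵇ-self G) r a∈r prune-r
    ... | q , locate-r with just-injective (trans (sym pruned) (cong (λ l′ → node? l′ (just r′)) l-kept))
                          | just-injective {y = right q} (trans (sym located) (locate-node-cong l-kept refl refl refl l-unlocated locate-r))
    ...   | refl | refl with w′
    ...     | straight _ wr′ = straight (≅-refl l) (graft-prune G r dr wr a∈r prune-r locate-r wr′)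
    ...     | cross _ wr′ with some-leaf r′
    ...       | y , y∈r′ = ⊥-elim (l#r (τ y) (∈ᵗ-step wr′ y∈r′) (∈ᵗ-step wr (proj₁ (∈ᵗ-pruned⁻ (inOrbitᵇ τ m a) a r prune-r y∈r′))))

    graft-prune-crossˡ : ∀ {τ m a} → PowerCycle τ (suc m) a → ∀ {l r} → Distinct l → Disjointᵗ l r →
      (wl : rename τ l ≅ r) (wr : rename τ r ≅ l) → a ∈ᵗ l →
      ∀ {t′ p} → prune (inOrbitᵇ τ (suc m) a) a (node l r) ≡ just t′ → locate (inOrbitᵇ τ (suc m) a) a (node l r) ≡ just p →
      (w′ : rename τ t′ ≅ t′) → graft τ (suc m) a t′ w′ p ≅ node l r
    graft-prune-crossˡ {τ} {m} {a} G {l} {r} dl l#r wl wr a∈l pruned located w′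
      with prune (inOrbitᵇ τ (suc m) a) a l in prune-l
    ... | nothing with () ← trans (sym (cong (node? nothing) (pruned-away-swap G wl prune-l))) pruned
    ... | just l′ with prune (inOrbitᵇ τ (suc m) a) a r in prune-r
    ...   | nothing with () ← trans (sym (pruned-away-swap G wr prune-r)) prune-l
    ...   | just r′ with locate-exists _ a (inOrbitᵇ-self G) l a∈l prune-l
    ...     | q , locate-l with just-injective pruned
                              | just-injective {y = left q} (trans (sym located) (locate-node-cong (refl {x = just l′}) (refl {x = just r′}) refl refl locate-l refl))
    ...       | refl | refl with w′
    ...         | cross wl′ wr′ = straight l⁺≅l (≅-trans (rename-≅ τ l⁺≅l) wl)
      where
        drop-agrees : ∀ x → x ∈ᵗ l → inOrbitᵇ τ (suc m) a x ≡ inOrbitᵇ (twice τ) m a x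
        drop-agrees x x∈ = inOrbitᵇ-cong G (PowerCycle-twice G) (InOrbit⇒InOrbit-twice wl wr a∈l l#r x∈) InOrbit-twice⇒InOrbit
        l⁺≅l : graft (twice τ) m a l′ (rename-twice-≅ wl′ wr′) q ≅ l
        l⁺≅l = graft-prune (PowerCycle-twice G) l dl (rename-twice-≅ wl wr) a∈l
                 (trans (sym (prune-ext _ _ a l drop-agrees)) prune-l) (trans (sym (locate-ext _ _ a l drop-agrees)) locate-l)
                 (rename-twice-≅ wl′ wr′)
    ...         | straight wl′ _ with some-leaf l′
    ...           | y , y∈l′ = ⊥-elim (l#r (τ y) (proj₁ (∈ᵗ-pruned⁻ (inOrbitᵇ τ (suc m) a) a l prune-l (∈ᵗ-step wl′ y∈l′)))
                                               (∈ᵗ-step wl (proj₁ (∈ᵗ-pruned⁻ (inOrbitᵇ τ (suc m) a) a l prune-l y∈l′))))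

    graft-prune-crossʳ : ∀ {τ m a} → PowerCycle τ (suc m) a → ∀ {l r} → Distinct r → Disjointᵗ l r →
      (wl : rename τ l ≅ r) (wr : rename τ r ≅ l) → a ∈ᵗ r →
      ∀ {t′ p} → prune (inOrbitᵇ τ (suc m) a) a (node l r) ≡ just t′ → locate (inOrbitᵇ τ (suc m) a) a (node l r) ≡ just p →
      (w′ : rename τ t′ ≅ t′) → graft τ (suc m) a t′ w′ p ≅ node l r
    graft-prune-crossʳ {τ} {m} {a} G {l} {r} dr l#r wl wr a∈r pruned located w′
      with prune (inOrbitᵇ τ (suc m) a) a l in prune-l
    ... | nothing with () ← trans (sym (cong (node? nothing) (pruned-away-swap G wl prune-l))) pruned
    ... | just l′ with prune (inOrbitᵇ τ (suc m) a) a r in prune-r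
    ...   | nothing with () ← trans (sym (pruned-away-swap G wr prune-r)) prune-l
    ...   | just r′ with locate-exists _ a (inOrbitᵇ-self G) r a∈r prune-r
    ...     | q , locate-r with just-injective pruned
                              | just-injective {y = right q} (trans (sym located)
                                  (locate-node-cong (refl {x = just l′}) (refl {x = just r′}) refl refl (∉⇒locate-nothing (inOrbitᵇ τ (suc m) a) a l λ a∈l → l#r a a∈l a∈r) locate-r))
    ...       | refl | refl with w′
    ...         | cross wl′ wr′ = straight (≅-trans (rename-≅ τ r⁺≅r) wr) r⁺≅r
      where
        drop-agrees : ∀ x → x ∈ᵗ r → inOrbitᵇ τ (suc m) a x ≡ inOrbitᵇ (twice τ) m a x
        drop-agrees x x∈ = inOrbitᵇ-cong G (PowerCycle-twice G)
                             (InOrbit⇒InOrbit-twice wr wl a∈r (λ y y∈r y∈l → l#r y y∈l y∈r) x∈) InOrbit-twice⇒InOrbit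
        r⁺≅r : graft (twice τ) m a r′ (rename-twice-≅ wr′ wl′) q ≅ r
        r⁺≅r = graft-prune (PowerCycle-twice G) r dr (rename-twice-≅ wr wl) a∈r
                 (trans (sym (prune-ext _ _ a r drop-agrees)) prune-r) (trans (sym (locate-ext _ _ a r drop-agrees)) locate-r)
                 (rename-twice-≅ wr′ wl′)
    ...         | straight _ wr′ with some-leaf r′
    ...           | y , y∈r′ = ⊥-elim (l#r (τ y) (∈ᵗ-step wr (proj₁ (∈ᵗ-pruned⁻ (inOrbitᵇ τ (suc m) a) a r prune-r y∈r′)))
                                               (proj₁ (∈ᵗ-pruned⁻ (inOrbitᵇ τ (suc m) a) a r prune-r (∈ᵗ-step wr′ y∈r′))))

-- The bijection

module _ {N : ℕ} (σ : Permutation′ N) where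

  ⟨$⟩ʳ-injective : ∀ {x y} → σ ⟨$⟩ʳ x ≡ σ ⟨$⟩ʳ y → x ≡ y
  ⟨$⟩ʳ-injective {x} {y} eq = trans (sym (inverseˡ σ)) (trans (cong (σ ⟨$⟩ˡ_) eq) (inverseˡ σ))

  SameCycle⇒InOrbit : ∀ {a x} → SameCycle σ a x → InOrbit (σ ⟨$⟩ʳ_) a x
  SameCycle⇒InOrbit {a} (k , eq) = k , trans (sym (iter≡iterate σ k a)) eq

  InOrbit⇒SameCycle : ∀ {a x} → InOrbit (σ ⟨$⟩ʳ_) a x → SameCycle σ a x
  InOrbit⇒SameCycle {a} (k , eq) = k , trans (iter≡iterate σ k a) eq

  relabel-invariant⇒ : ∀ {t} → relabel σ t ≅ t → rename (σ ⟨$⟩ʳ_) t ≅ t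
  relabel-invariant⇒ {t} = subst (_≅ t) (relabel≡rename σ t)

  relabel-invariant⇐ : ∀ {t} → rename (σ ⟨$⟩ʳ_) t ≅ t → relabel σ t ≅ t
  relabel-invariant⇐ {t} = subst (_≅ t) (sym (relabel≡rename σ t))

  iter-returns : ∀ x → ∃ λ K → 1 ≤ K × iter σ K x ≡ x
  iter-returns x with pigeonhole (n<1+n N) (λ (i : Fin (suc N)) → iter σ (toℕ i) x)
  ... | i , j , i<j , eq = toℕ j ∸ toℕ i , m<n⇒0<n∸m i<j ,
    trans (iter≡iterate σ (toℕ j ∸ toℕ i) x) (iterate-injective _ ⟨$⟩ʳ-injective (toℕ i) (begin
      iterate (σ ⟨$⟩ʳ_) (toℕ i) (iterate (σ ⟨$⟩ʳ_) (toℕ j ∸ toℕ i) x) ≡⟨ iterate-+ _ (toℕ i) (toℕ j ∸ toℕ i) x ⟨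
      iterate (σ ⟨$⟩ʳ_) (toℕ i + (toℕ j ∸ toℕ i)) x                 ≡⟨ cong (λ n → iterate _ n x) (m+[n∸m]≡n (<⇒≤ i<j)) ⟩
      iterate (σ ⟨$⟩ʳ_) (toℕ j) x                                    ≡⟨ iter≡iterate σ (toℕ j) x ⟨
      iter σ (toℕ j) x                                               ≡⟨ eq ⟨
      iter σ (toℕ i) x                                               ≡⟨ iter≡iterate σ (toℕ i) x ⟩
      iterate (σ ⟨$⟩ʳ_) (toℕ i) x                                    ∎))
    where open ≡-Reasoning

  cycle-length : ∀ x → ∃ (IsCycleLen σ x)
  cycle-length x = let K , 1≤K , returns-at-K = iter-returns x in <-rec Minimal shortest K 1≤K returns-at-K
    where
      Minimal : ℕ → Set
      Minimal K = 1 ≤ K → iter σ K x ≡ x → ∃ (IsCycleLen σ x)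
      shortest : ∀ K → (∀ {k} → k < K → Minimal k) → Minimal K
      shortest K rec 1≤K returns-at-K with anyUpTo? (λ k → (1 ≤? k) ×-dec (iter σ k x ≟ x)) K
      ... | yes (k , k<K , 1≤k , returns-at-k) = rec k<K 1≤k returns-at-k
      ... | no none = K , 1≤K , returns-at-K , λ k 1≤k k<K returns-at-k → none (k , k<K , 1≤k , returns-at-k)

  PowerCycle-of-cycle : ∀ {a m} → IsCycleLen σ a (2 ^ m) → (∀ x → iterate (σ ⟨$⟩ʳ_) (2 ^ m) x ≡ x) →
                        PowerCycle (σ ⟨$⟩ʳ_) m a
  PowerCycle-of-cycle {a} (_ , _ , shortest) periodic = record
    { injective    = ⟨$⟩ʳ-injective
    ; periodic     = periodic
    ; exact-period = λ i 1≤i i< eq → shortest i 1≤i i< (trans (iter≡iterate σ i a) eq) }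

  iterate-cycle-length : ∀ {x L} → IsCycleLen σ x L → iterate (σ ⟨$⟩ʳ_) L x ≡ x
  iterate-cycle-length {x} {L} (_ , returns-at-L , _) = trans (sym (iter≡iterate σ L x)) returns-at-L

module _ {N : ℕ} {P : Fin N → Set} where

  Valid⇒Distinct : ∀ {t} → Valid P t → Distinct t
  Valid⇒Distinct {t} (unique , _) = Unique⇒Distinct t unique

  Valid⇒∈ᵗ : ∀ {t} → Valid P t → ∀ {x} → P x → x ∈ᵗ t
  Valid⇒∈ᵗ {t} (_ , leaves⇔P) Px = ∈-leaves⇒∈ᵗ t (Equivalence.from (leaves⇔P _) Px)

  ∈ᵗ⇒Valid : ∀ {t} → Valid P t → ∀ {x} → x ∈ᵗ t → P x
  ∈ᵗ⇒Valid (_ , leaves⇔P) x∈ = Equivalence.to (leaves⇔P _) (∈ᵗ⇒∈-leaves x∈)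

  mkValid : ∀ {t} → Distinct t → (∀ {x} → x ∈ᵗ t → P x) → (∀ {x} → P x → x ∈ᵗ t) → Valid P t
  mkValid {t} dt t⊆P P⊆t = Distinct⇒Unique t dt , λ x → mk⇔ (t⊆P ∘ ∈-leaves⇒∈ᵗ t) (∈ᵗ⇒∈-leaves ∘ P⊆t)

module _ {N : ℕ} (σ : Permutation′ N) where

  cycleTree-exactly-one : ∀ {m a} → PowerCycle (σ ⟨$⟩ʳ_) m a → (∀ x → SameCycle σ a x) → ExactlyOne {σ = σ} {P = Everything}
  cycleTree-exactly-one {m} {a} G one-cycle = γ , λ (t , valid , invariant) →
    cycleTree-unique G t (Valid⇒Distinct valid) (relabel-invariant⇒ σ invariant)
      (λ x _ → SameCycle⇒InOrbit σ (one-cycle x)) (λ x _ → Valid⇒∈ᵗ valid tt)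
    where
      ∈-cycleTree : ∀ x → x ∈ᵗ cycleTree (σ ⟨$⟩ʳ_) m a
      ∈-cycleTree x with InOrbit⇒InOrbitBelow G (SameCycle⇒InOrbit σ (one-cycle x))
      ... | i , i< , refl = ∈ᵗ-cycleTree⁺ _ m a i<
      γ : Bσ σ Everything
      γ = cycleTree (σ ⟨$⟩ʳ_) m a ,
          mkValid (Distinct-cycleTree _ m a (iterate-injective-below G)) (λ _ → tt) (λ {x} _ → ∈-cycleTree x) ,
          relabel-invariant⇐ σ (cycleTree-invariant _ m a (periodic G a))

module _ {n : ℕ} (σ : Permutation′ (suc n)) (binary : BinaryCycleType σ) where

  one-cycle-PowerCycle : OneCycle σ → ∃ λ m → PowerCycle (σ ⟨$⟩ʳ_) m zero
  one-cycle-PowerCycle one-cycle with cycle-length σ zero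
  ... | L , isL with binary zero L isL
  ... | m , refl = m , PowerCycle-of-cycle σ isL λ x →
    InOrbit-periodic {P = 2 ^ m} (iterate-cycle-length σ isL) (SameCycle⇒InOrbit σ (one-cycle zero x))

  max-cycle-PowerCycle : ∀ a → MaxCycle σ a → ∃ λ m → PowerCycle (σ ⟨$⟩ʳ_) m a
  max-cycle-PowerCycle a (L , isL , maximal) with binary a L isL
  ... | m , refl = m , PowerCycle-of-cycle σ isL all-periodic
    where
      all-periodic : ∀ x → iterate (σ ⟨$⟩ʳ_) (2 ^ m) x ≡ x
      all-periodic x with cycle-length σ x
      ... | ℓ , isℓ with binary x ℓ isℓ
      ... | j , refl with j ≤? m
      ...   | no j≰m  = ⊥-elim (<⇒≱ (^-monoʳ-< 2 (s≤s (s≤s z≤n)) (≰⇒> j≰m)) (maximal x (2 ^ j) isℓ))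
      ...   | yes j≤m = subst (λ k → iterate _ k x ≡ x) (trans (sym (^-distribˡ-+-* 2 (m ∸ j) j)) (cong (2 ^_) (m∸n+n≡m j≤m)))
                          (iterate-periodic _ (iterate-cycle-length σ isℓ) (2 ^ (m ∸ j)))

  outside-orbit : ¬ OneCycle σ → ∀ {m a} → PowerCycle (σ ⟨$⟩ʳ_) m a → ∃ λ x → ¬ InOrbit (σ ⟨$⟩ʳ_) a x
  outside-orbit not-one-cycle G = ¬∀⟶∃¬ (suc n) _ (InOrbit? G) λ all-in-orbit →
    not-one-cycle λ x y → InOrbit⇒SameCycle σ (InOrbit-trans (InOrbit-sym G (all-in-orbit x)) (all-in-orbit y))

-- x₀ lies outside the cycle of a, so that no tree on all of Fin N is pruned away completely.
module Bijection {N : ℕ} (σ : Permutation′ N) {m a} (G : PowerCycle (σ ⟨$⟩ʳ_) m a)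
                 (x₀ : Fin N) (x₀∉ : ¬ InOrbit (σ ⟨$⟩ʳ_) a x₀) where

  open Pruning (inOrbitᵇ (σ ⟨$⟩ʳ_) m a) a

  Rest : Fin N → Set
  Rest x = ¬ SameCycle σ a x

  record Decomposition (t : Tree {N}) : Set where
    field
      pruned  : Tree {N}
      prune≡  : prune t ≡ just pruned
      path    : Path
      locate≡ : locate t ≡ just path
      path-in : PathIn pruned path

  decompose : ∀ t → a ∈ᵗ t → x₀ ∈ᵗ t → Decomposition t
  decompose t a∈ x₀∈ with prune t in prune≡
  ... | nothing = ⊥-elim (x₀∉ (inOrbitᵇ-sound {m = m} (prune≡nothing⇒dropped t prune≡ x₀∈)))
  ... | just t′ with locate-exists (inOrbitᵇ-self G) t a∈ prune≡
  ...   | p , locate≡ = record { pruned = t′ ; prune≡ = prune≡ ; path = p ; locate≡ = locate≡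
                               ; path-in = locate-PathIn t locate≡ prune≡ }

  module Cut (γ : Bσ σ Everything) where
    tree : Tree {N}
    tree = proj₁ γ

    distinct : Distinct tree
    distinct = Valid⇒Distinct (proj₁ (proj₂ γ))

    ∈tree : ∀ x → x ∈ᵗ tree
    ∈tree x = Valid⇒∈ᵗ (proj₁ (proj₂ γ)) tt

    invariant : rename (σ ⟨$⟩ʳ_) tree ≅ tree
    invariant = relabel-invariant⇒ σ (proj₂ (proj₂ γ))

    open Decomposition (decompose tree (∈tree a) (∈tree x₀)) public

    pruned-invariant : rename (σ ⟨$⟩ʳ_) pruned ≅ pruned
    pruned-invariant with ≅ᵐ-just (trans (prune-rename (σ ⟨$⟩ʳ_) (inOrbitᵇ-step G) tree) (cong (Maybe.map _) prune≡)) prune≡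
                                  (prune-≅ invariant)
    ... | j , _ = j

    pruned-valid : Valid Rest pruned
    pruned-valid = mkValid (Distinctᵐ-just (Distinct-prune tree distinct))
      (λ x∈ x∈cycle → dropped≢kept (trans (sym (inOrbitᵇ-complete G (SameCycle⇒InOrbit σ x∈cycle)))
                                                (proj₂ (∈ᵗ-pruned⁻ tree prune≡ x∈))))
      (λ {x} x∉cycle → subst (x ∈ᵐ_) prune≡ (∈ᵐ-prune⁺ tree (∈tree x) (inOrbitᵇ-false {m = m} (x∉cycle ∘ InOrbit⇒SameCycle σ))))
      where
        Distinctᵐ-just : Distinctᵐ (prune tree) → Distinct pruned
        Distinctᵐ-just = subst Distinctᵐ prune≡
        dropped≢kept : true ≢ false
        dropped≢kept ()

    edge : Edge pruned
    edge = edgeAt pruned path path-in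

    pathOf-edge : pathOf edge ≡ path
    pathOf-edge = pathOf-edgeAt pruned path path-in

  cut : Bσ σ Everything → Eσ σ Rest
  cut γ = (pruned , pruned-valid , relabel-invariant⇐ σ pruned-invariant) , edge
    where open Cut γ

  cut-cong : ∀ {γ δ} → _≈B_ {σ = σ} {P = Everything} γ δ → _≈E_ {σ = σ} {P = Rest} (cut γ) (cut δ)
  cut-cong {γ} {δ} γ≅δ with ≅ᵐ-just (Cut.prune≡ γ) (Cut.prune≡ δ) (prune-≅ γ≅δ)
  ... | j , transport≡ = j , transport-by-path j (Cut.edge γ) (Cut.edge δ) (begin
    transportPath j (pathOf (Cut.edge γ))  ≡⟨ cong (transportPath j) (Cut.pathOf-edge γ) ⟩
    transportPath j (Cut.path γ)           ≡⟨ transport≡ (Cut.path γ) ⟨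
    transportPathᵐ (prune-≅ γ≅δ) (Cut.path γ) ≡⟨ just-injective (begin
      just (transportPathᵐ (prune-≅ γ≅δ) (Cut.path γ))        ≡⟨ cong (Maybe.map _) (Cut.locate≡ γ) ⟨
      Maybe.map (transportPathᵐ (prune-≅ γ≅δ)) (locate (Cut.tree γ)) ≡⟨ locate-≅ (Cut.distinct γ) γ≅δ ⟨
      locate (Cut.tree δ)                                      ≡⟨ Cut.locate≡ δ ⟩
      just (Cut.path δ)                                        ∎) ⟩
    Cut.path δ                             ≡⟨ Cut.pathOf-edge δ ⟨
    pathOf (Cut.edge δ)                    ∎)
    where open ≡-Reasoning

  graft-cut : ∀ γ → graft (σ ⟨$⟩ʳ_) m a (Cut.pruned γ) (Cut.pruned-invariant γ) (Cut.path γ) ≅ Cut.tree γ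
  graft-cut γ = graft-prune G tree distinct invariant (∈tree a) prune≡ locate≡ pruned-invariant
    where open Cut γ

  cut-injective : ∀ {γ δ} → _≈E_ {σ = σ} {P = Rest} (cut γ) (cut δ) → _≈B_ {σ = σ} {P = Everything} γ δ
  cut-injective {γ} {δ} (j , transport≡) =
    ≅-trans (≅-sym (graft-cut γ))
      (≅-trans (subst (λ p → graft _ m a _ (Cut.pruned-invariant γ) (Cut.path γ) ≅ graft _ m a _ (Cut.pruned-invariant δ) p)
                      path≡ (graft-cong j _ _ (Cut.path γ) (Cut.path-in γ) (Valid⇒Distinct (Cut.pruned-valid γ))))
               (graft-cut δ))
    where
      open ≡-Reasoning
      path≡ : transportPath j (Cut.path γ) ≡ Cut.path δ
      path≡ = begin
        transportPath j (Cut.path γ)          ≡⟨ cong (transportPath j) (Cut.pathOf-edge γ) ⟨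
        transportPath j (pathOf (Cut.edge γ)) ≡⟨ pathOf-transport j (Cut.edge γ) ⟨
        pathOf (transport j (Cut.edge γ))     ≡⟨ cong pathOf transport≡ ⟩
        pathOf (Cut.edge δ)                   ≡⟨ Cut.pathOf-edge δ ⟩
        Cut.path δ                            ∎

  private
    edge-iso : ∀ {s s′ t : Tree {N}} → s ≡ s′ → (i : s′ ≅ t) (e : Edge s) (e′ : Edge t) → ∀ q →
               pathOf e ≡ q → transportPath i q ≡ pathOf e′ → Σ (s ≅ t) λ j → transport j e ≡ e′
    edge-iso refl i e e′ q e≡q i-q≡e′ = i , transport-by-path i e e′ (trans (cong (transportPath i) e≡q) i-q≡e′)

  cut-surjective : ∀ ε → ∃ λ γ → _≈E_ {σ = σ} {P = Rest} (cut γ) ε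
  cut-surjective ((t , valid , relabel-inv) , e) = γ , edge-iso pruned≡ pruned≅ (Cut.edge γ) e path path≡′ path≡
    where
      w : rename (σ ⟨$⟩ʳ_) t ≅ t
      w = relabel-invariant⇒ σ relabel-inv
      dt : Distinct t
      dt = Valid⇒Distinct valid
      avoid : AvoidsOrbit (σ ⟨$⟩ʳ_) a t
      avoid x x∈ = ∈ᵗ⇒Valid valid x∈ ∘ InOrbit⇒SameCycle σ
      grafted : Tree {N}
      grafted = graft (σ ⟨$⟩ʳ_) m a t w (pathOf e)
      ∈grafted : ∀ x → x ∈ᵗ grafted
      ∈grafted x with InOrbit? G x
      ... | yes x∈orbit = graft-∈ᵗ-orbit G t w (pathOf e) (PathIn-pathOf e) dt x∈orbit
      ... | no x∉orbit  = graft-∈ᵗ⁺ G t w (pathOf e) (PathIn-pathOf e) dt (Valid⇒∈ᵗ valid (x∉orbit ∘ SameCycle⇒InOrbit σ))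
      γ : Bσ σ Everything
      γ = grafted , mkValid (Distinct-graft G t w (pathOf e) (PathIn-pathOf e) dt avoid) (λ _ → tt) (λ {x} _ → ∈grafted x) ,
          relabel-invariant⇐ σ (graft-invariant G t w (pathOf e) (PathIn-pathOf e) dt)
      open PrunesTo (prune-graft G t w (pathOf e) (PathIn-pathOf e) dt avoid)
      pruned≡ : Cut.pruned γ ≡ pruned
      pruned≡ = just-injective (trans (sym (Cut.prune≡ γ)) prune≡)
      path≡′ : pathOf (Cut.edge γ) ≡ path
      path≡′ = trans (Cut.pathOf-edge γ) (just-injective (trans (sym (Cut.locate≡ γ)) locate≡))

  bijection : Bij (_≈B_ {σ = σ} {P = Everything}) (_≈E_ {σ = σ} {P = Rest})
  bijection = record { f = cut ; cong = λ {γ} {δ} → cut-cong {γ} {δ} ; inj = λ {γ} {δ} → cut-injective {γ} {δ} ; surj = cut-surjective }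

theorem1 : ∀ (n : ℕ) (σ : Permutation′ (suc n)) → BinaryCycleType σ →
    (OneCycle σ → ExactlyOne {σ = σ} {P = Everything})
    × (¬ OneCycle σ → ∀ a → MaxCycle σ a →
    Bij (_≈B_ {σ = σ} {P = Everything})
    (_≈E_ {σ = σ} {P = λ x → ¬ SameCycle σ a x}))
theorem1 n σ binary = single-cycle , several-cycles
  where
    single-cycle : OneCycle σ → ExactlyOne {σ = σ} {P = Everything}
    single-cycle one-cycle =
      let _ , G = one-cycle-PowerCycle σ binary one-cycle in cycleTree-exactly-one σ G (one-cycle zero)

    several-cycles : ¬ OneCycle σ → ∀ a → MaxCycle σ a →
                     Bij (_≈B_ {σ = σ} {P = Everything}) (_≈E_ {σ = σ} {P = λ x → ¬ SameCycle σ a x})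
    several-cycles not-one-cycle a maximal =
      let _ , G      = max-cycle-PowerCycle σ binary a maximal
          x₀ , x₀∉   = outside-orbit σ binary not-one-cycle G
      in Bijection.bijection σ G x₀ x₀∉
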